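{- There is a polynomial $p$ such that every false PCNF formula $\Phi$ with at most $q$ quantifier blocks and pathwidth at most $k$ has an $\mathrm{OBDD}(\land,\exists,\forall)$-refutation of size at most $\mathrm{tower}(k,q+1)\cdot p(|\Phi|)$.
   Context: A PCNF formula is $\Phi = Q_1x_1\ldots Q_nx_n.\,C_1\land\dots\land C_m$ with $Q_i\in\{\exists,\forall\}$, distinct variables $x_i$ and clauses $C_j$; a quantifier block is a maximal run of consecutive equal quantifiers in the prefix. $\Phi$ is false iff there is a universal winning strategy (functions $f_u$ for universal $u$, depending only on variables left of $u$, such that every existential assignment extended by the $f_u$ falsifies the matrix). The primal graph of $\Phi$ has the variables as vertices and an edge between two variables if they occur together in a clause; the pathwidth of $\Phi$ is the pathwidth of its primal graph (minimum over path decompositions — sequences of bags covering all vertices and edges, with each vertex's bags contiguous — of maximum bag size minus one). $\mathrm{tower}(k,0)=k$ and $\mathrm{tower}(k,j+1)=2^{\mathrm{tower}(k,j)}$. For a linear order $\pi$ of the variables, a $\pi$-OBDD is a DAG with one source and sinks $0,1$, non-sink nodes labelled by variables and having outgoing edges labelled $0$ and $1$, variables appearing along each path in order $\pi$; size is number of nodes. An $\mathrm{OBDD}(\land,\exists,\forall)$ derivation from $\Phi$ is a sequence $L_1,\dots,L_k$ of OBDDs with a common order $\pi$, where $L_i$ represents $C_i$ for $i\le m$ and each other $L_i$ is obtained by: conjunction ($L_i$ represents $L_j\land L_{j'}$, $j,j'<i$), projection ($L_i$ represents $\exists x.L_j$ for a variable $x$ of $L_j$, $j<i$), or universal reduction ($L_i$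 represents $L_j[u/c]$, $j<i$, $u$ universal and rightmost in the prefix among the variables of $L_j$, $c\in\{0,1\}$). Size is the sum of OBDD sizes; a refutation ends with an OBDD representing $0$. -}

module Defs where

open import Data.Nat using (ℕ; zero; suc; _+_; _*_; _^_; _≤_)
open import Data.Bool using (Bool; true; false; if_then_else_; not; _∧_; _∨_)
open import Data.Fin using (Fin; toℕ; _≟_) renaming (_<_ to _<ᶠ_; _≤_ to _≤ᶠ_)
open import Data.Fin.Permutation using (Permutation′; _⟨$⟩ʳ_)
open import Data.Fin.Subset using (Subset; ∣_∣) renaming (_∈_ to _∈ₛ_)
open import Data.Vec using (Vec; []; _∷_; lookup; toList)
open import Data.List using (List; map; length)
open import Data.Bool.ListAction using (any)
open import Data.Nat.ListAction using (sum)
open import Data.List.Membership.Propositional using (_∈_)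
open import Data.Product using (Σ; ∃; _×_; _,_; proj₁; proj₂)
open import Data.Sum using (_⊎_)
open import Data.Unit using (⊤)
open import Relation.Binary.PropositionalEquality using (_≡_; _≢_)
open import Relation.Nullary using (yes; no)

tower : ℕ → ℕ → ℕ
tower k zero    = k
tower k (suc j) = 2 ^ tower k j

Poly : Set
Poly = List ℕ

evalPoly : Poly → ℕ → ℕ
evalPoly List.[]       x = 0
evalPoly (c List.∷ cs) x = c + x * evalPoly cs x

sumFin : (r : ℕ) → (Fin r → ℕ) → ℕ
sumFin zero    f = 0
sumFin (suc r) f = f Fin.zero + sumFin r (λ i → f (Fin.suc i))

data Quant : Set where
  ∃q ∀q : Quant

sameQ : Quant → Quant → Bool
sameQ ∃q ∃q = true
sameQ ∀q ∀q = true
sameQ _  _  = false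

blocks : ∀ {n} → Vec Quant n → ℕ
blocks []                = 0
blocks (q ∷ [])          = 1
blocks (q ∷ (q' ∷ qs))   = (if sameQ q q' then 0 else 1) + blocks (q' ∷ qs)

-- A literal over variables Fin n: (x , true) is x, (x , false) is ¬x.
Literal : ℕ → Set
Literal n = Fin n × Bool

Clause : ℕ → Set
Clause n = List (Literal n)

Assignment : ℕ → Set
Assignment n = Fin n → Bool

-- Variables x₀,…,x_{n-1} are quantified in this order (prefix order =
-- order of Fin n); the matrix has m clauses C₀,…,C_{m-1}.
record PCNF : Set where
  field
    n       : ℕ
    prefix  : Vec Quant n
    m       : ℕ
    clauses : Vec (Clause n) m

  Q : Fin n → Quant
  Q x = lookup prefix x

open PCNF public

evalLit : ∀ {n} → Assignment n → Literal n → Bool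
evalLit a (x , b) = if b then a x else not (a x)

evalClause : ∀ {n} → Assignment n → Clause n → Bool
evalClause a C = any (evalLit a) C

formulaSize : PCNF → ℕ
formulaSize Φ = n Φ + m Φ + sum (map length (toList (clauses Φ)))

Falsifies : (Φ : PCNF) → Assignment (n Φ) → Set
Falsifies Φ a = Σ (Fin (m Φ)) λ c → evalClause a (lookup (clauses Φ) c) ≡ false

-- Universal strategy: a function f u for every variable u (only used for
-- universal u), where f u depends only on the variables left of u.
record UStrategy (Φ : PCNF) : Set where
  field
    f     : Fin (n Φ) → Assignment (n Φ) → Bool
    local : ∀ u (α β : Assignment (n Φ)) →
            (∀ i → i <ᶠ u → α i ≡ β i) → f u α ≡ f u β

-- The assignments obtained by extending an existential assignment by the
-- strategy are exactly those assignments a with a u = f u a for all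
-- universal u (by locality there is exactly one per existential part).
Winning : (Φ : PCNF) → UStrategy Φ → Set
Winning Φ σ = ∀ (a : Assignment (n Φ)) →
  (∀ u → Q Φ u ≡ ∀q → a u ≡ UStrategy.f σ u a) → Falsifies Φ a

IsFalse : PCNF → Set
IsFalse Φ = Σ (UStrategy Φ) λ σ → Winning Φ σ

Occurs : ∀ {n} → Fin n → Clause n → Set
Occurs x C = x ∈ map proj₁ C

PrimalEdge : (Φ : PCNF) → Fin (n Φ) → Fin (n Φ) → Set
PrimalEdge Φ x y = x ≢ y ×
  Σ (Fin (m Φ)) λ c → Occurs x (lookup (clauses Φ) c) × Occurs y (lookup (clauses Φ) c)

record PathDecomposition (Φ : PCNF) : Set where
  field
    r      : ℕ
    bag    : Fin r → Subset (n Φ)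
    vcover : ∀ v → Σ (Fin r) λ i → v ∈ₛ bag i
    ecover : ∀ x y → PrimalEdge Φ x y → Σ (Fin r) λ i → x ∈ₛ bag i × y ∈ₛ bag i
    contig : ∀ v (i j l : Fin r) → i ≤ᶠ j → j ≤ᶠ l → v ∈ₛ bag i → v ∈ₛ bag l → v ∈ₛ bag j

WidthAtMost : ∀ {Φ} → PathDecomposition Φ → ℕ → Set
WidthAtMost D k = ∀ i → ∣ PathDecomposition.bag D i ∣ ≤ suc k

PathwidthAtMost : PCNF → ℕ → Set
PathwidthAtMost Φ k = Σ (PathDecomposition Φ) λ D → WidthAtMost D k

data Node (n s : ℕ) : Set where
  sink   : Bool → Node n s
  branch : (x : Fin n) (lo hi : Fin s) → Node n s

rank : ∀ {n} → Permutation′ n → Fin n → Fin n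
rank π x = π ⟨$⟩ʳ x

ChildOK : ∀ {n s} → Permutation′ n → Fin n → Node n s → Set
ChildOK π x (sink b)         = ⊤
ChildOK π x (branch y _ _)   = rank π x <ᶠ rank π y

-- A π-OBDD with suc s nodes; node zero is the source.  Strictly increasing
-- π-rank along edges gives acyclicity and the path-order condition.
record OBDD (n : ℕ) (π : Permutation′ n) : Set where
  field
    s       : ℕ
    node    : Fin (suc s) → Node n (suc s)
    ordered : ∀ i x lo hi → node i ≡ branch x lo hi →
              ChildOK π x (node lo) × ChildOK π x (node hi)

  size : ℕ
  size = suc s

open OBDD public

data Eval {n π} (L : OBDD n π) (a : Assignment n) : Fin (suc (s L)) → Bool → Set where
  atSink : ∀ {i b} → node L i ≡ sink b → Eval L a i b
  go0    : ∀ {i x lo hi b} → node L i ≡ branch x lo hi → a x ≡ false →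
           Eval L a lo b → Eval L a i b
  go1    : ∀ {i x lo hi b} → node L i ≡ branch x lo hi → a x ≡ true →
           Eval L a hi b → Eval L a i b

Represents : ∀ {n π} → OBDD n π → (Assignment n → Bool) → Set
Represents L f = ∀ a → Eval L a Fin.zero (f a)

VarOf : ∀ {n π} → OBDD n π → Fin n → Set
VarOf L x = Σ (Fin (suc (s L))) λ i → Σ (Fin (suc (s L))) λ lo → Σ (Fin (suc (s L))) λ hi →
  node L i ≡ branch x lo hi

_[_↦_] : ∀ {n} → Assignment n → Fin n → Bool → Assignment n
(a [ x ↦ b ]) y with y ≟ x
... | yes _ = b
... | no  _ = a y

module _ (Φ : PCNF) (π : Permutation′ (n Φ)) where

  data Inference {len : ℕ} (L : Fin len → OBDD (n Φ) π) (i : Fin len) : Set where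
    conj : (j j' : Fin len) → j <ᶠ i → j' <ᶠ i →
           (f g : Assignment (n Φ) → Bool) → Represents (L j) f → Represents (L j') g →
           Represents (L i) (λ a → f a ∧ g a) → Inference L i
    proj : (j : Fin len) → j <ᶠ i → (x : Fin (n Φ)) → VarOf (L j) x →
           (f : Assignment (n Φ) → Bool) → Represents (L j) f →
           Represents (L i) (λ a → f (a [ x ↦ false ]) ∨ f (a [ x ↦ true ])) →
           Inference L i
    ured : (j : Fin len) → j <ᶠ i → (u : Fin (n Φ)) → Q Φ u ≡ ∀q →
           VarOf (L j) u → (∀ v → VarOf (L j) v → v ≤ᶠ u) → (c : Bool) →
           (f : Assignment (n Φ) → Bool) → Represents (L j) f →
           Represents (L i) (λ a → f (a [ u ↦ c ])) → Inference L i

  Justified : {len : ℕ} (L : Fin len → OBDD (n Φ) π) (i : Fin len) → Set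
  Justified L i =
    (Σ (Fin (m Φ)) λ c → toℕ c ≡ toℕ i ×
       Represents (L i) (λ a → evalClause a (lookup (clauses Φ) c)))
    ⊎ (m Φ ≤ toℕ i × Inference L i)

  record Derivation : Set where
    field
      len       : ℕ
      line      : Fin len → OBDD (n Φ) π
      hasAxioms : m Φ ≤ len
      justified : ∀ i → Justified line i

  derivationSize : Derivation → ℕ
  derivationSize D = sumFin (Derivation.len D) (λ i → size (Derivation.line D i))

  IsRefutation : Derivation → Set
  IsRefutation D = Σ (Fin (Derivation.len D)) λ last →
    suc (toℕ last) ≡ Derivation.len D × Represents (Derivation.line D last) (λ _ → false)

{-# OPTIONS --safe #-}
-- Order the variables by the first bag of the path decomposition that contains them. For this
-- order every Boolean function we need has an OBDD whose width is controlled by a layering: the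
-- node reached at level r is a "state" depending only on the variables below r. A conjunction of
-- clauses needs only 2^k states, since the variables below r that still occur in unfinished
-- clauses all lie in one bag. Quantifying a whole block of variables is a subset construction
-- on the states, so each quantifier block costs one exponential and every function stays within
-- width tower(k, q+1). The refutation conjoins the clauses and then eliminates the variables
-- innermost first, ∃x by projection and ∀x by two universal reductions and a conjunction; the
-- universal winning strategy shows that the final function is 0. That is 2m + 3n lines, each an
-- OBDD with at most 3 + n·tower(k, q+1) nodes.
module Submission where

open import Defs
open import Data.Bool using (Bool; true; false; if_then_else_; not; _∧_; _∨_)
open import Data.Bool.Properties using () renaming (_≟_ to _≟ᵇ_)
open import Data.Bool.Properties using (∨-zeroʳ; ∧-conicalˡ; ∧-conicalʳ; ∧-zeroʳ; ∧-idem; not-involutive; not-injective)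
open import Data.Empty using (⊥; ⊥-elim)
open import Data.Fin as F using (Fin; toℕ; _≟_)
import Data.Fin.Properties as FP
open import Data.Fin.Subset as Sub using (Subset)
open import Data.Fin.Subset.Properties using (p⊂q⇒∣p∣<∣q∣; ∣⊤∣≡n; ∈⊤)
open import Data.Fin.Permutation using (Permutation′; _⟨$⟩ʳ_; _⟨$⟩ˡ_; inverseˡ; inverseʳ; permutation)
open import Data.List using (List; []; _∷_; allFin; map)
open import Data.List.Relation.Unary.All as All using (All)
open import Data.List.Relation.Unary.All.Properties using (¬All⇒Any¬)
open import Data.List.Membership.Propositional using (_∈_; _∉_; find)
open import Data.List.Membership.Propositional.Properties using (∈-allFin)
open import Data.List.Relation.Unary.Any using (here; there)
open import Data.Maybe as Maybe using (Maybe; just; nothing; is-just; fromMaybe; _<∣>_)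
open import Data.Maybe.Properties using (≡-dec)
open import Data.Vec as V using (Vec; _∷ʳ_)
import Data.Vec.Properties as VP
open import Data.Nat as N using (ℕ; zero; suc; _+_; _*_; _^_; _∸_; _≤_; _<_; z≤n; s≤s)
import Data.Nat.Properties as NP
open import Data.Product using (Σ; _×_; _,_; proj₁; proj₂)
open import Function.Bundles using (_⇔_; mk⇔; Equivalence)
open import Data.Sum using (_⊎_; inj₁; inj₂)
open import Relation.Binary.PropositionalEquality using (_≡_; _≢_; refl; sym; trans; cong; cong₂; subst; subst₂)
open import Relation.Nullary using (Dec; yes; no; does)
open import Relation.Nullary.Decidable using (dec-true; dec-false)
open import Relation.Binary.Definitions using (tri<; tri≈; tri>)
open import Data.Nat.Solver using (module +-*-Solver)
open +-*-Solver using (solve; _:+_; _:*_; _:=_; con)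

bool-ext : ∀ {x y : Bool} → (x ≡ true → y ≡ true) → (y ≡ true → x ≡ true) → x ≡ y
bool-ext {false} {false} _ _ = refl
bool-ext {false} {true}  _ g = g refl
bool-ext {true}  {false} f _ = sym (f refl)
bool-ext {true}  {true}  _ _ = refl

∧-intro : ∀ {x y} → x ≡ true → y ≡ true → x ∧ y ≡ true
∧-intro refl refl = refl

not-false : ∀ {x} → x ≡ false → not x ≡ true
not-false refl = refl

does-true⇒ : ∀ {A : Set} (d : Dec A) → does d ≡ true → A
does-true⇒ (yes a) _ = a

does-∧ : ∀ {A B : Set} (a? : Dec A) (b? : Dec B) → does a? ∧ does b? ≡ true → A × B
does-∧ (yes a) (yes b) _ = a , b

if-just : ∀ {A : Set} b (v w : A) → (if b then just v else nothing) ≡ just w → b ≡ true × v ≡ w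
if-just true v .v refl = refl , refl

if-nothing : ∀ {A : Set} b (v : A) → (if b then just v else nothing) ≡ nothing → b ≡ false
if-nothing false v _ = refl

update-same : ∀ {n} (a : Assignment n) x b → (a [ x ↦ b ]) x ≡ b
update-same a x b with x ≟ x
... | yes _ = refl
... | no x≢x = ⊥-elim (x≢x refl)

update-other : ∀ {n} (a : Assignment n) x b y → y ≢ x → (a [ x ↦ b ]) y ≡ a y
update-other a x b y y≢x with y ≟ x
... | yes y≡x = ⊥-elim (y≢x y≡x)
... | no _ = refl

update-cong : ∀ {n} (a a′ : Assignment n) x b y → (y ≢ x → a y ≡ a′ y) → (a [ x ↦ b ]) y ≡ (a′ [ x ↦ b ]) y
update-cong a a′ x b y agree with y ≟ x
... | yes _ = refl
... | no y≢x = agree y≢x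

AgreeOutside : ∀ {n} → (Fin n → Bool) → Assignment n → Assignment n → Set
AgreeOutside D a c = ∀ y → D y ≡ false → a y ≡ c y

Extensional : ∀ {n} → (Assignment n → Bool) → Set
Extensional P = ∀ a c → (∀ y → a y ≡ c y) → P a ≡ P c

DependsOn : ∀ {n} → (Fin n → Bool) → (Assignment n → Bool) → Set
DependsOn U P = ∀ a c → (∀ y → U y ≡ true → a y ≡ c y) → P a ≡ P c

DependsOn⇒Extensional : ∀ {n} {U : Fin n → Bool} {P} → DependsOn U P → Extensional P
DependsOn⇒Extensional dep a c agree = dep a c (λ y _ → agree y)

module Search {n : ℕ} (D : Fin n → Bool) (P : Assignment n → Bool) where

  searchOver : List (Fin n) → Assignment n → Maybe (Assignment n)
  searchOver [] a = if P a then just a else nothing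
  searchOver (x ∷ xs) a =
    if D x then searchOver xs (a [ x ↦ false ]) <∣> searchOver xs (a [ x ↦ true ]) else searchOver xs a

  AgreeOff : List (Fin n) → Assignment n → Assignment n → Set
  AgreeOff xs a c = ∀ y → D y ≡ false ⊎ y ∉ xs → a y ≡ c y

  private
    off-tail : ∀ {x xs y} → D y ≡ false ⊎ y ∉ x ∷ xs → D y ≡ false ⊎ y ∉ xs
    off-tail (inj₁ Dy) = inj₁ Dy
    off-tail (inj₂ y∉) = inj₂ (λ y∈ → y∉ (there y∈))

    off-head : ∀ {x xs y} → D x ≡ true → D y ≡ false ⊎ y ∉ x ∷ xs → y ≢ x
    off-head Dx (inj₁ Dy) refl with trans (sym Dy) Dx
    ... | ()
    off-head Dx (inj₂ y∉) refl = y∉ (here refl)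

    on-head : ∀ {x xs y} → D y ≡ false ⊎ y ∉ xs → y ≢ x → D y ≡ false ⊎ y ∉ x ∷ xs
    on-head (inj₁ Dy) _ = inj₁ Dy
    on-head (inj₂ y∉) y≢x = inj₂ λ { (here y≡x) → y≢x y≡x ; (there y∈) → y∉ y∈ }

  searchOver-sound : ∀ xs a c → searchOver xs a ≡ just c → P c ≡ true × AgreeOff xs a c
  searchOver-sound-step : ∀ x xs a b c → D x ≡ true → searchOver xs (a [ x ↦ b ]) ≡ just c →
    P c ≡ true × AgreeOff (x ∷ xs) a c

  searchOver-sound [] a c found with P a in Pa
  searchOver-sound [] a .a refl | true = Pa , λ _ _ → refl
  searchOver-sound (x ∷ xs) a c found with D x in Dx
  ... | false = let (Pc , agree) = searchOver-sound xs a c found in Pc , λ y off → agree y (off-tail off)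
  ... | true with searchOver xs (a [ x ↦ false ]) in found₀
  ...   | just _  = searchOver-sound-step x xs a false c Dx (trans found₀ found)
  ...   | nothing = searchOver-sound-step x xs a true c Dx found

  searchOver-sound-step x xs a b c Dx found = let (Pc , agree) = searchOver-sound xs _ c found in
    Pc , λ y off → trans (sym (update-other a x b y (off-head Dx off))) (agree y (off-tail off))

  is-just-<∣> : ∀ (m₁ m₂ : Maybe (Assignment n)) → is-just (m₁ <∣> m₂) ≡ is-just m₁ ∨ is-just m₂
  is-just-<∣> (just _) m₂ = refl
  is-just-<∣> nothing  m₂ = refl

  searchOver-complete : Extensional P → ∀ xs a c → AgreeOff xs a c → P c ≡ true →
    is-just (searchOver xs a) ≡ true
  searchOver-complete ext [] a c agree Pc with P a in Pa
  ... | true  = refl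
  ... | false with trans (sym Pa) (trans (ext a c (λ y → agree y (inj₂ λ ()))) Pc)
  ...   | ()
  searchOver-complete ext (x ∷ xs) a c agree Pc with D x in Dx
  ... | false = searchOver-complete ext xs a c (λ y off → agree y (on-tail off)) Pc
    where
    on-tail : ∀ {y} → D y ≡ false ⊎ y ∉ xs → D y ≡ false ⊎ y ∉ x ∷ xs
    on-tail {y} off with y ≟ x
    ... | yes refl = inj₁ Dx
    ... | no y≢x = on-head off y≢x
  ... | true = trans (is-just-<∣> (searchOver xs (a [ x ↦ false ])) _) (pick (c x) refl)
    where
    agree-chosen : ∀ b → c x ≡ b → AgreeOff xs (a [ x ↦ b ]) c
    agree-chosen b cx y off with y ≟ x
    ... | yes refl = sym cx
    ... | no y≢x = agree y (on-head off y≢x)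
    found : ∀ b → c x ≡ b → is-just (searchOver xs (a [ x ↦ b ])) ≡ true
    found b cx = searchOver-complete ext xs _ c (agree-chosen b cx) Pc
    pick : ∀ b → c x ≡ b →
      is-just (searchOver xs (a [ x ↦ false ])) ∨ is-just (searchOver xs (a [ x ↦ true ])) ≡ true
    pick false cx rewrite found false cx = refl
    pick true  cx rewrite found true cx = ∨-zeroʳ _

module _ {n : ℕ} where

  witness : (Fin n → Bool) → (Assignment n → Bool) → Assignment n → Maybe (Assignment n)
  witness D P = Search.searchOver D P (allFin n)

  -- (∃ D. P) a, which ignores the values of a on D
  exists : (Fin n → Bool) → (Assignment n → Bool) → Assignment n → Bool
  exists D P a = is-just (witness D P a)

  witness-sound : ∀ D P (a c : Assignment n) → witness D P a ≡ just c → P c ≡ true × AgreeOutside D a c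
  witness-sound D P a c found =
    let (Pc , agree) = Search.searchOver-sound D P (allFin n) a c found in Pc , λ y Dy → agree y (inj₁ Dy)

  exists-sound : ∀ D P (a : Assignment n) → exists D P a ≡ true → Σ (Assignment n) λ c → P c ≡ true × AgreeOutside D a c
  exists-sound D P a ex with witness D P a in found
  ... | just c = c , witness-sound D P a c found

  exists-intro : ∀ D P → Extensional P → (a c : Assignment n) → AgreeOutside D a c → P c ≡ true → exists D P a ≡ true
  exists-intro D P ext a c agree Pc = Search.searchOver-complete D P ext (allFin n) a c agree′ Pc
    where
    agree′ : Search.AgreeOff D P (allFin n) a c
    agree′ y (inj₁ Dy) = agree y Dy
    agree′ y (inj₂ y∉) = ⊥-elim (y∉ (∈-allFin y))

  exists-dependsOn : ∀ D U P → DependsOn U P → DependsOn (λ x → U x ∧ not (D x)) (exists D P)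
  exists-dependsOn D U P dep a a′ agree = bool-ext (transport a a′ agree) (transport a′ a (λ y u → sym (agree y u)))
    where
    transport : ∀ a a′ → (∀ y → U y ∧ not (D y) ≡ true → a y ≡ a′ y) → exists D P a ≡ true → exists D P a′ ≡ true
    transport a a′ agree ex with exists-sound D P a ex
    ... | c , Pc , a≈c = exists-intro D P (DependsOn⇒Extensional dep) a′ mix mix-outside (trans (dep mix c mix-on-U) Pc)
      where
      mix : Assignment n
      mix x = if D x then c x else a′ x
      mix-outside : AgreeOutside D a′ mix
      mix-outside y Dy rewrite Dy = refl
      mix-on-U : ∀ y → U y ≡ true → mix y ≡ c y
      mix-on-U y Uy with D y in Dy
      ... | true  = refl
      ... | false = trans (sym (agree y (∧-intro Uy (not-false Dy)))) (a≈c y Dy)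

  exists-∅ : ∀ D P → Extensional P → (∀ y → D y ≡ false) → ∀ a → exists D P a ≡ P a
  exists-∅ D P ext D-empty a = bool-ext sound (exists-intro D P ext a a (λ _ _ → refl))
    where
    sound : exists D P a ≡ true → P a ≡ true
    sound ex with exists-sound D P a ex
    ... | c , Pc , a≈c = trans (ext a c (λ y → a≈c y (D-empty y))) Pc

  exists-split : ∀ D D′ P x → Extensional P → (∀ y → D′ y ≡ true → D y ≡ true) →
    (∀ y → D y ≡ true → D′ y ≡ false → y ≡ x) → D x ≡ true →
    ∀ a → exists D P a ≡ exists D′ P (a [ x ↦ false ]) ∨ exists D′ P (a [ x ↦ true ])
  exists-split D D′ P x ext D′⊆D D∖D′⊆x Dx a = bool-ext split join
    where
    ∨-pick : ∀ b {u v : Bool} → (if b then v else u) ≡ true → u ∨ v ≡ true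
    ∨-pick false {true} _ = refl
    ∨-pick true {false} {true} _ = refl
    ∨-pick true {true} _ = refl
    ∨-choose : ∀ {u v : Bool} → u ∨ v ≡ true → Σ Bool λ b → (if b then v else u) ≡ true
    ∨-choose {true} _ = false , refl
    ∨-choose {false} {true} _ = true , refl
    chosen : ∀ b → (if b then exists D′ P (a [ x ↦ true ]) else exists D′ P (a [ x ↦ false ])) ≡ exists D′ P (a [ x ↦ b ])
    chosen false = refl
    chosen true = refl
    split : exists D P a ≡ true → exists D′ P (a [ x ↦ false ]) ∨ exists D′ P (a [ x ↦ true ]) ≡ true
    split ex with exists-sound D P a ex
    ... | c , Pc , a≈c = ∨-pick (c x) (trans (chosen (c x)) (exists-intro D′ P ext (a [ x ↦ c x ]) c agree Pc))
      where
      agree : AgreeOutside D′ (a [ x ↦ c x ]) c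
      agree y D′y with y ≟ x
      ... | yes refl = refl
      ... | no y≢x = a≈c y (outside (D y) refl)
        where
        outside : ∀ b → D y ≡ b → D y ≡ false
        outside false Dy = Dy
        outside true Dy = ⊥-elim (y≢x (D∖D′⊆x y Dy D′y))
    join : exists D′ P (a [ x ↦ false ]) ∨ exists D′ P (a [ x ↦ true ]) ≡ true → exists D P a ≡ true
    join ex with ∨-choose ex
    ... | b , exb with exists-sound D′ P (a [ x ↦ b ]) (trans (sym (chosen b)) exb)
    ...   | c , Pc , ab≈c = exists-intro D P ext a c agree Pc
      where
      agree : AgreeOutside D a c
      agree y Dy with y ≟ x
      ... | yes refl with trans (sym Dy) Dx
      ...   | ()
      agree y Dy | no y≢x = trans (sym (update-other a x b y y≢x)) (ab≈c y (outside (D′ y) refl))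
        where
        outside : ∀ b → D′ y ≡ b → D′ y ≡ false
        outside false D′y = D′y
        outside true D′y with trans (sym (D′⊆D y D′y)) Dy
        ... | ()

least : ∀ {R} → (Fin R → Bool) → Maybe (Fin R)
least {zero} p = nothing
least {suc R} p = if p F.zero then just F.zero else Maybe.map F.suc (least (λ i → p (F.suc i)))

least-just : ∀ {R} (p : Fin R → Bool) i → least p ≡ just i → p i ≡ true × (∀ j → p j ≡ true → toℕ i ≤ toℕ j)
least-just {suc R} p i found with p F.zero in p0
least-just {suc R} p .F.zero refl | true = p0 , λ _ _ → z≤n
... | false with least (λ i → p (F.suc i)) in found′
least-just {suc R} p .(F.suc i) refl | false | just i =
  let (pi , minimal) = least-just (λ i → p (F.suc i)) i found′ in pi , minimal′ minimal
  where
  minimal′ : (∀ j → p (F.suc j) ≡ true → toℕ i ≤ toℕ j) → ∀ j → p j ≡ true → suc (toℕ i) ≤ toℕ j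
  minimal′ minimal F.zero pj with trans (sym pj) p0
  ... | ()
  minimal′ minimal (F.suc j) pj = s≤s (minimal j pj)

least-nothing : ∀ {R} (p : Fin R → Bool) → least p ≡ nothing → ∀ j → p j ≡ false
least-nothing {suc R} p none j with p F.zero in p0
... | false with least (λ i → p (F.suc i)) in none′
least-nothing {suc R} p none F.zero | false | nothing = p0
least-nothing {suc R} p none (F.suc j) | false | nothing = least-nothing (λ i → p (F.suc i)) none′ j

bit : Bool → Fin 2
bit false = F.zero
bit true  = F.suc F.zero

bit-injective : ∀ {x y} → bit x ≡ bit y → x ≡ y
bit-injective {false} {false} _ = refl
bit-injective {true}  {true}  _ = refl

encode : ∀ W → (Fin W → Bool) → Fin (2 ^ W)
encode W f = F.funToFin (λ i → bit (f i))

encode-injective : ∀ W (f h : Fin W → Bool) → encode W f ≡ encode W h → ∀ i → f i ≡ h i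
encode-injective W f h eq i = bit-injective
  (trans (sym (FP.finToFun-funToFin (λ j → bit (f j)) i))
    (trans (cong (λ k → F.finToFun k i) eq) (FP.finToFun-funToFin (λ j → bit (h j)) i)))

encode-cong : ∀ W (f h : Fin W → Bool) → (∀ i → f i ≡ h i) → encode W f ≡ encode W h
encode-cong zero    f h same = refl
encode-cong (suc W) f h same =
  cong₂ F.combine (cong bit (same F.zero)) (encode-cong W _ _ (λ i → same (F.suc i)))

subset : ∀ {n} → (Fin n → Bool) → Subset n
subset p = V.tabulate p

∈-subset⁺ : ∀ {n} (p : Fin n → Bool) {x} → p x ≡ true → x Sub.∈ subset p
∈-subset⁺ p {x} px = VP.lookup⇒[]= x (subset p) (trans (VP.lookup∘tabulate p x) px)

∈-subset⁻ : ∀ {n} (p : Fin n → Bool) {x} → x Sub.∈ subset p → p x ≡ true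
∈-subset⁻ p {x} x∈ = trans (sym (VP.lookup∘tabulate p x)) (VP.[]=⇒lookup x∈)

encodeOn : ∀ {n} (p : Subset n) → (Fin n → Bool) → Fin (2 ^ Sub.∣ p ∣)
encodeOn V.[] f = F.zero
encodeOn (false V.∷ p) f = encodeOn p (λ i → f (F.suc i))
encodeOn (true V.∷ p) f = F.combine (bit (f F.zero)) (encodeOn p (λ i → f (F.suc i)))

encodeOn-injective : ∀ {n} (p : Subset n) f h → encodeOn p f ≡ encodeOn p h → ∀ x → x Sub.∈ p → f x ≡ h x
encodeOn-injective (false V.∷ p) f h eq (F.suc x) (V.there x∈) = encodeOn-injective p _ _ eq x x∈
encodeOn-injective (true V.∷ p) f h eq F.zero V.here =
  bit-injective (proj₁ (FP.combine-injective (bit (f F.zero)) (encodeOn p _) (bit (h F.zero)) (encodeOn p _) eq))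
encodeOn-injective (true V.∷ p) f h eq (F.suc x) (V.there x∈) =
  encodeOn-injective p _ _ (proj₂ (FP.combine-injective (bit (f F.zero)) (encodeOn p _) (bit (h F.zero)) (encodeOn p _) eq)) x x∈

encodeOn-cong : ∀ {n} (p : Subset n) f h → (∀ x → x Sub.∈ p → f x ≡ h x) → encodeOn p f ≡ encodeOn p h
encodeOn-cong V.[] f h same = refl
encodeOn-cong (false V.∷ p) f h same = encodeOn-cong p _ _ (λ x x∈ → same (F.suc x) (V.there x∈))
encodeOn-cong (true V.∷ p) f h same =
  cong₂ F.combine (cong bit (same F.zero V.here)) (encodeOn-cong p _ _ (λ x x∈ → same (F.suc x) (V.there x∈)))

anyTrue : ∀ {m} → (Fin m → Bool) → Bool
anyTrue p = does (FP.any? (λ i → p i ≟ᵇ true))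

anyTrue-sound : ∀ {m} (p : Fin m → Bool) → anyTrue p ≡ true → Σ (Fin m) λ i → p i ≡ true
anyTrue-sound p = does-true⇒ (FP.any? _)

anyTrue-intro : ∀ {m} (p : Fin m → Bool) i → p i ≡ true → anyTrue p ≡ true
anyTrue-intro p i pi = dec-true (FP.any? _) (i , pi)

anyTrue-cong : ∀ {m} (p q : Fin m → Bool) → (∀ i → p i ≡ q i) → anyTrue p ≡ anyTrue q
anyTrue-cong p q same = bool-ext
  (λ t → let (i , pi) = anyTrue-sound p t in anyTrue-intro q i (trans (sym (same i)) pi))
  (λ t → let (i , qi) = anyTrue-sound q t in anyTrue-intro p i (trans (same i) qi))

vars : ∀ {n} → Clause n → List (Fin n)
vars C = map proj₁ C

evalClause-cong : ∀ {n} (C : Clause n) (a a′ : Assignment n) → (∀ x → x ∈ vars C → a x ≡ a′ x) →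
  evalClause a C ≡ evalClause a′ C
evalClause-cong [] a a′ same = refl
evalClause-cong ((x , b) ∷ C) a a′ same =
  cong₂ _∨_ (cong (λ v → if b then v else not v) (same x (here refl)))
            (evalClause-cong C a a′ (λ y y∈ → same y (there y∈)))


injective⇒surjective : ∀ {n} (f : Fin n → Fin n) → (∀ {x y} → f x ≡ f y → x ≡ y) →
  ∀ y → Σ (Fin n) λ x → f x ≡ y
injective⇒surjective {suc n} f f-inj y with FP.any? (λ x → f x ≟ y)
... | yes hit = hit
... | no miss = ⊥-elim (NP.<-irrefl refl (FP.injective⇒≤ {f = squeeze} squeeze-injective))
  where
  avoids : ∀ x → y ≢ f x
  avoids x eq = miss (x , sym eq)
  squeeze : Fin (suc n) → Fin n
  squeeze x = F.punchOut (avoids x)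
  squeeze-injective : ∀ {x z} → squeeze x ≡ squeeze z → x ≡ z
  squeeze-injective eq = f-inj (FP.punchOut-injective (avoids _) (avoids _) eq)

module SortBy {n : ℕ} (key : Fin n → ℕ) (key-injective : ∀ {x y} → key x ≡ key y → x ≡ y) where

  smaller : Fin n → Subset n
  smaller x = subset (λ y → does (key y N.<? key x))

  not-smaller : ∀ x → x Sub.∉ smaller x
  not-smaller x x∈ = NP.<-irrefl refl (does-true⇒ (key x N.<? key x) (∈-subset⁻ _ x∈))

  position : Fin n → ℕ
  position x = Sub.∣ smaller x ∣

  position<n : ∀ x → position x < n
  position<n x = subst (position x <_) (∣⊤∣≡n n) (p⊂q⇒∣p∣<∣q∣ ((λ _ → ∈⊤) , x , ∈⊤ , not-smaller x))

  position-mono : ∀ x y → key x < key y → position x < position y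
  position-mono x y x<y = p⊂q⇒∣p∣<∣q∣ (grow , x , ∈-subset⁺ _ (dec-true (key x N.<? key y) x<y) , not-smaller x)
    where
    grow : smaller x Sub.⊆ smaller y
    grow z∈ = ∈-subset⁺ _ (dec-true (_ N.<? key y) (NP.<-trans (does-true⇒ (_ N.<? key x) (∈-subset⁻ _ z∈)) x<y))

  position-injective : ∀ {x y} → position x ≡ position y → x ≡ y
  position-injective {x} {y} eq with NP.<-cmp (key x) (key y)
  ... | tri< lt _ _ = ⊥-elim (NP.<⇒≢ (position-mono x y lt) eq)
  ... | tri≈ _ ≡k _ = key-injective ≡k
  ... | tri> _ _ gt = ⊥-elim (NP.<⇒≢ (position-mono y x gt) (sym eq))

  sortedRank : Fin n → Fin n
  sortedRank x = F.fromℕ< (position<n x)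

  sortedRank-injective : ∀ {x y} → sortedRank x ≡ sortedRank y → x ≡ y
  sortedRank-injective {x} {y} eq =
    position-injective (trans (sym (FP.toℕ-fromℕ< _)) (trans (cong toℕ eq) (FP.toℕ-fromℕ< _)))

  sorting : Permutation′ n
  sorting = permutation sortedRank (λ y → proj₁ (onto y)) (λ y → proj₂ (onto y))
    (λ x → sortedRank-injective (proj₂ (onto (sortedRank x))))
    where
    onto = injective⇒surjective sortedRank sortedRank-injective

  sorting-sorts : ∀ x y → toℕ (sorting ⟨$⟩ʳ x) < toℕ (sorting ⟨$⟩ʳ y) → key x < key y
  sorting-sorts x y lt with NP.<-cmp (key x) (key y)
  ... | tri< k< _ _ = k<
  ... | tri≈ _ k≡ _ rewrite key-injective k≡ = ⊥-elim (NP.<-irrefl refl lt)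
  ... | tri> _ _ k> = ⊥-elim (NP.<-asym lt
          (subst₂ _<_ (sym (FP.toℕ-fromℕ< _)) (sym (FP.toℕ-fromℕ< _)) (position-mono y x k>)))

connective : Quant → Bool → Bool → Bool
connective ∃q = _∨_
connective ∀q = _∧_

module Layering {n : ℕ} (π : Permutation′ n) where

  level : Fin n → ℕ
  level x = toℕ (rank π x)

  varAt : Fin n → Fin n
  varAt r = π ⟨$⟩ˡ r

  level-varAt : ∀ r → level (varAt r) ≡ toℕ r
  level-varAt r = cong toℕ (inverseʳ π)

  varAt-rank : ∀ x → varAt (rank π x) ≡ x
  varAt-rank x = inverseˡ π

  level-injective : ∀ {x y} → level x ≡ level y → x ≡ y
  level-injective {x} {y} eq = trans (sym (varAt-rank x)) (trans (cong varAt (FP.toℕ-injective eq)) (varAt-rank y))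

  splice : Fin n → Assignment n → Assignment n → Assignment n
  splice r c a x = if does (level x N.<? toℕ r) then c x else a x

  splice-below : ∀ r c a x → level x < toℕ r → splice r c a x ≡ c x
  splice-below r c a x lt rewrite dec-true (level x N.<? toℕ r) lt = refl

  splice-above : ∀ r c a x → toℕ r ≤ level x → splice r c a x ≡ a x
  splice-above r c a x ge rewrite dec-false (level x N.<? toℕ r) (NP.≤⇒≯ ge) = refl

  PrefixDependent : ∀ {A : Set} → Fin n → (Assignment n → A) → Set
  PrefixDependent r f = ∀ a a′ → (∀ x → level x < toℕ r → a x ≡ a′ x) → f a ≡ f a′

  -- state r a is the node (one of W) that an OBDD for fun reaches on a at level r;
  -- nothing stands for the 0-sink.
  record Layered (W : ℕ) : Set where
    field
      support      : Fin n → Bool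
      fun          : Assignment n → Bool
      state        : Fin n → Assignment n → Maybe (Fin W)
      state-prefix : ∀ r → PrefixDependent r (state r)
      state-suffix : ∀ r a a′ → state r a ≡ state r a′ → (∀ x → toℕ r ≤ level x → a x ≡ a′ x) →
                     fun a ≡ fun a′
      state-dead   : ∀ r a → state r a ≡ nothing → fun a ≡ false
      fun-support  : DependsOn support fun

    state-splice : ∀ r c a → state r (splice r c a) ≡ state r c
    state-splice r c a = state-prefix r _ _ (splice-below r c a)

    _≟ₛ_ : (u v : Maybe (Fin W)) → Dec (u ≡ v)
    _≟ₛ_ = ≡-dec _≟_

    hasState : Fin n → Fin W → Assignment n → Bool
    hasState r s c = does (state r c ≟ₛ just s)

    hasState-prefix : ∀ r s → PrefixDependent r (hasState r s)
    hasState-prefix r s a a′ agree = cong (λ m → does (m ≟ₛ just s)) (state-prefix r a a′ agree)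

  module ToOBDD {W : ℕ} (S : Layered W) where
    open Layered S

    nextFrom : ℕ → Maybe (Fin n)
    nextFrom k = least (λ r → does (k N.≤? toℕ r) ∧ support (varAt r))

    nextFrom-just : ∀ k r → nextFrom k ≡ just r → k ≤ toℕ r × support (varAt r) ≡ true ×
      (∀ x → k ≤ level x → level x < toℕ r → support x ≡ false)
    nextFrom-just k r found =
      does-true⇒ (k N.≤? toℕ r) (∧-conicalˡ _ _ pr) , ∧-conicalʳ _ _ pr , skipped
      where
      pr = proj₁ (least-just _ r found)
      skipped : ∀ x → k ≤ level x → level x < toℕ r → support x ≡ false
      skipped x k≤x x<r with support x in Sx
      ... | false = refl
      ... | true = ⊥-elim (NP.<⇒≱ x<r (proj₂ (least-just _ r found) (rank π x)
                     (∧-intro (dec-true (k N.≤? level x) k≤x) (trans (cong support (varAt-rank x)) Sx))))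

    nextFrom-nothing : ∀ k → nextFrom k ≡ nothing → ∀ x → k ≤ level x → support x ≡ false
    nextFrom-nothing k none x k≤x =
      trans (sym (cong support (varAt-rank x)))
        (subst (λ d → d ∧ support (varAt (rank π x)) ≡ false) (dec-true (k N.≤? level x) k≤x)
          (least-nothing _ none (rank π x)))

    -- node 0 is the source (a copy of the root), nodes 1 and 2 are the sinks,
    -- and node 3 + (r , s) is state s at level r
    Index : Set
    Index = Fin (3 + n * W)

    sinkIndex : Bool → Index
    sinkIndex false = F.suc F.zero
    sinkIndex true  = F.suc (F.suc F.zero)

    nodeIndex : Fin n → Fin W → Index
    nodeIndex r s = 3 F.↑ʳ F.combine r s

    stateIndex : Fin n → Maybe (Fin W) → Index
    stateIndex r nothing  = sinkIndex false
    stateIndex r (just s) = nodeIndex r s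

    childIndex : Maybe (Fin n) → Assignment n → Index
    childIndex (just r′) β = stateIndex r′ (state r′ β)
    childIndex nothing   β = sinkIndex (fun β)

    representative : Fin n → Fin W → Assignment n
    representative r s = fromMaybe (λ _ → false) (witness (λ _ → true) (hasState r s) (λ _ → false))

    representative-state : ∀ r s c → state r c ≡ just s → state r (representative r s) ≡ just s
    representative-state r s c cs
      with witness (λ _ → true) (hasState r s) (λ _ → false) in found
         | exists-intro (λ _ → true) (hasState r s) (λ a c agree → hasState-prefix r s a c (λ x _ → agree x))
             (λ _ → false) c (λ _ ()) (dec-true (_ ≟ₛ _) cs)
    ... | just c′ | _ = does-true⇒ (_ ≟ₛ _) (proj₁ (witness-sound _ _ _ c′ found))

    child : Fin n → Fin W → Bool → Index
    child r s b = childIndex (nextFrom (suc (toℕ r))) (representative r s [ varAt r ↦ b ])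

    layerNode : Fin n → Fin W → Bool → Node n (3 + n * W)
    layerNode r s true  = branch (varAt r) (child r s false) (child r s true)
    layerNode r s false = sink false

    layerNodeAt : Fin n × Fin W → Node n (3 + n * W)
    layerNodeAt (r , s) = layerNode r s (support (varAt r))

    nodeAt : Index → Node n (3 + n * W)
    nodeAt i with F.splitAt 3 i
    ... | inj₁ F.zero = sink false
    ... | inj₁ (F.suc F.zero) = sink false
    ... | inj₁ (F.suc (F.suc F.zero)) = sink true
    ... | inj₂ k = layerNodeAt (F.remQuot W k)

    rootIndex : Index
    rootIndex = childIndex (nextFrom 0) (λ _ → false)

    node′ : Index → Node n (3 + n * W)
    node′ F.zero    = nodeAt rootIndex
    node′ (F.suc i) = nodeAt (F.suc i)

    node′-copy : ∀ i → Σ Index λ j → node′ i ≡ nodeAt j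
    node′-copy F.zero    = rootIndex , refl
    node′-copy (F.suc i) = F.suc i , refl

    node′-sinkIndex : ∀ b → node′ (sinkIndex b) ≡ sink b
    node′-sinkIndex false = refl
    node′-sinkIndex true  = refl

    node′-nodeIndex : ∀ r s → node′ (nodeIndex r s) ≡ layerNode r s (support (varAt r))
    node′-nodeIndex r s = cong layerNodeAt (FP.remQuot-combine r s)

    BranchShape : Node n (3 + n * W) → Set
    BranchShape (sink _) = ⊥
    BranchShape (branch x lo hi) = Σ (Fin n) λ r → Σ (Fin W) λ s →
      support (varAt r) ≡ true × x ≡ varAt r × lo ≡ child r s false × hi ≡ child r s true

    nodeAt-branch : ∀ i x lo hi → nodeAt i ≡ branch x lo hi → BranchShape (branch x lo hi)
    nodeAt-branch i x lo hi eq with F.splitAt 3 i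
    nodeAt-branch i x lo hi () | inj₁ F.zero
    nodeAt-branch i x lo hi () | inj₁ (F.suc F.zero)
    nodeAt-branch i x lo hi () | inj₁ (F.suc (F.suc F.zero))
    ... | inj₂ k = layerNodeAt-branch (F.remQuot W k) eq
      where
      layerNodeAt-branch : ∀ p → layerNodeAt p ≡ branch x lo hi → BranchShape (branch x lo hi)
      layerNodeAt-branch (r , s) eq′ with support (varAt r) in Sr
      layerNodeAt-branch (r , s) refl | true = r , s , Sr , refl , refl , refl

    child-ordered : ∀ r β → ChildOK π (varAt r) (node′ (childIndex (nextFrom (suc (toℕ r))) β))
    child-ordered r β with nextFrom (suc (toℕ r)) in found
    ... | nothing = subst (ChildOK π (varAt r)) (sym (node′-sinkIndex (fun β))) _
    ... | just r′ with state r′ β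
    ...   | nothing = _
    ...   | just s′ = let (r<r′ , Sr′ , _) = nextFrom-just _ r′ found in
      subst (ChildOK π (varAt r)) (sym (trans (node′-nodeIndex r′ s′) (cong (layerNode r′ s′) Sr′)))
        (subst₂ _<_ (sym (level-varAt r)) (sym (level-varAt r′)) r<r′)

    ordered′ : ∀ i x lo hi → node′ i ≡ branch x lo hi → ChildOK π x (node′ lo) × ChildOK π x (node′ hi)
    ordered′ i x lo hi eq with node′-copy i
    ... | j , copy with nodeAt-branch j x lo hi (trans (sym copy) eq)
    ...   | r , s , _ , refl , refl , refl = child-ordered r _ , child-ordered r _

    diagram : OBDD n π
    diagram = record { s = 2 + n * W ; node = node′ ; ordered = ordered′ }

    eval-copy : ∀ {a i j b} → node′ i ≡ node′ j → Eval diagram a j b → Eval diagram a i b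
    eval-copy same (atSink eq)      = atSink (trans same eq)
    eval-copy same (go0 eq ax path) = go0 (trans same eq) ax path
    eval-copy same (go1 eq ax path) = go1 (trans same eq) ax path

    node′-childIndex : ∀ m β → node′ (childIndex m β) ≡ nodeAt (childIndex m β)
    node′-childIndex (just r) β with state r β
    ... | nothing = refl
    ... | just _  = refl
    node′-childIndex nothing β with fun β
    ... | false = refl
    ... | true  = refl

    updated-splice : ∀ r (α a : Assignment n) b → a (varAt r) ≡ b →
      ∀ x → level x ≤ toℕ r → (α [ varAt r ↦ b ]) x ≡ splice r α a x
    updated-splice r α a b ab x x≤r with NP.m≤n⇒m<n∨m≡n x≤r
    ... | inj₁ x<r = trans (update-other α (varAt r) b x (λ eq → NP.<⇒≢ x<r (trans (cong level eq) (level-varAt r))))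
                           (sym (splice-below r α a x x<r))
    ... | inj₂ x≡r with level-injective {x} {varAt r} (trans x≡r (sym (level-varAt r)))
    ...   | refl = trans (update-same α (varAt r) b)
                     (trans (sym ab) (sym (splice-above r α a (varAt r) (NP.≤-reflexive (sym x≡r)))))

    EvalFrom : ℕ → Set
    EvalFrom d = ∀ r → n ∸ toℕ r ≤ d → support (varAt r) ≡ true →
      ∀ c a → Eval diagram a (stateIndex r (state r c)) (fun (splice r c a))

    eval-child : ∀ d → EvalFrom d → ∀ r → n ∸ toℕ r ≤ suc d → ∀ α a b → a (varAt r) ≡ b →
      Eval diagram a (childIndex (nextFrom (suc (toℕ r))) (α [ varAt r ↦ b ])) (fun (splice r α a))
    eval-child d ih r fuel α a b ab with nextFrom (suc (toℕ r)) in found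
    ... | just r′ = subst (Eval diagram a _) (fun-support _ _ agree) (ih r′ fuel′ Sr′ (α [ varAt r ↦ b ]) a)
      where
      next = nextFrom-just _ r′ found
      r<r′ = proj₁ next
      Sr′ = proj₁ (proj₂ next)
      fuel′ : n ∸ toℕ r′ ≤ d
      fuel′ = NP.≤-pred (NP.≤-trans (NP.∸-monoʳ-< r<r′ (NP.<⇒≤ (FP.toℕ<n r′))) fuel)
      agree : ∀ x → support x ≡ true → splice r′ (α [ varAt r ↦ b ]) a x ≡ splice r α a x
      agree x Sx with level x N.≤? toℕ r
      ... | yes x≤r = trans (splice-below r′ (α [ varAt r ↦ b ]) a x (NP.≤-<-trans x≤r r<r′))
                            (updated-splice r α a b ab x x≤r)
      ... | no x≰r with level x N.<? toℕ r′
      ...   | yes x<r′ with trans (sym Sx) (proj₂ (proj₂ next) x (NP.≰⇒> x≰r) x<r′)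
      ...     | ()
      agree x Sx | no x≰r | no x≮r′ =
        trans (splice-above r′ (α [ varAt r ↦ b ]) a x (NP.≮⇒≥ x≮r′))
              (sym (splice-above r α a x (NP.<⇒≤ (NP.≰⇒> x≰r))))
    ... | nothing = subst (Eval diagram a _) (fun-support _ _ agree) (atSink (node′-sinkIndex _))
      where
      agree : ∀ x → support x ≡ true → (α [ varAt r ↦ b ]) x ≡ splice r α a x
      agree x Sx with level x N.≤? toℕ r
      ... | yes x≤r = updated-splice r α a b ab x x≤r
      ... | no x≰r with trans (sym Sx) (nextFrom-nothing _ found x (NP.≰⇒> x≰r))
      ...   | ()

    eval-state : ∀ d → EvalFrom d
    eval-state zero r fuel _ c a = ⊥-elim (NP.<⇒≱ (NP.m<n⇒0<n∸m (FP.toℕ<n r)) fuel)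
    eval-state (suc d) r fuel Sr c a with state r c in cs
    ... | nothing = subst (Eval diagram a (sinkIndex false)) (sym dead) (atSink refl)
      where
      dead : fun (splice r c a) ≡ false
      dead = state-dead r (splice r c a) (trans (state-splice r c a) cs)
    ... | just s = subst (Eval diagram a (nodeIndex r s)) same-fun (step (a (varAt r)) refl)
      where
      α = representative r s
      same-fun : fun (splice r α a) ≡ fun (splice r c a)
      same-fun = state-suffix r _ _
        (trans (state-splice r α a) (trans (representative-state r s c cs) (sym (trans (state-splice r c a) cs))))
        (λ x r≤x → trans (splice-above r α a x r≤x) (sym (splice-above r c a x r≤x)))
      at-node : node′ (nodeIndex r s) ≡ branch (varAt r) (child r s false) (child r s true)
      at-node = trans (node′-nodeIndex r s) (cong (layerNode r s) Sr)
      step : ∀ b → a (varAt r) ≡ b → Eval diagram a (nodeIndex r s) (fun (splice r α a))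
      step false ab = go0 at-node ab (eval-child d (eval-state d) r fuel α a false ab)
      step true  ab = go1 at-node ab (eval-child d (eval-state d) r fuel α a true ab)

    eval-root : ∀ a → Eval diagram a (childIndex (nextFrom 0) (λ _ → false)) (fun a)
    eval-root a with nextFrom 0 in found
    ... | just r₀ = subst (Eval diagram a _) (fun-support _ _ agree)
                      (eval-state n r₀ (NP.m∸n≤m n (toℕ r₀)) (proj₁ (proj₂ first)) (λ _ → false) a)
      where
      first = nextFrom-just 0 r₀ found
      agree : ∀ x → support x ≡ true → splice r₀ (λ _ → false) a x ≡ a x
      agree x Sx with level x N.<? toℕ r₀
      ... | yes x<r₀ with trans (sym Sx) (proj₂ (proj₂ first) x z≤n x<r₀)
      ...   | ()
      agree x Sx | no x≮r₀ = splice-above r₀ _ a x (NP.≮⇒≥ x≮r₀)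
    ... | nothing = subst (Eval diagram a _) (fun-support _ _ agree) (atSink (node′-sinkIndex _))
      where
      agree : ∀ x → support x ≡ true → false ≡ a x
      agree x Sx with trans (sym Sx) (nextFrom-nothing 0 found x z≤n)
      ... | ()

    represents : Represents diagram fun
    represents a = eval-copy (sym (node′-childIndex (nextFrom 0) (λ _ → false))) (eval-root a)

    varOf-support : ∀ x → VarOf diagram x → support x ≡ true
    varOf-support x (i , lo , hi , eq) with node′-copy i
    ... | j , copy with nodeAt-branch j x lo hi (trans (sym copy) eq)
    ...   | r , s , Sr , refl , _ , _ = Sr

    support-varOf : ∀ x → support x ≡ true → Fin W → VarOf diagram x
    support-varOf x Sx s = nodeIndex r s , child r s false , child r s true ,
      subst (λ y → node′ (nodeIndex r s) ≡ branch y (child r s false) (child r s true)) (varAt-rank x)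
        (trans (node′-nodeIndex r s) (cong (layerNode r s) (trans (cong support (varAt-rank x)) Sx)))
      where
      r = rank π x

  restrict : ∀ {W} → Layered W → Fin n → Bool → Layered W
  restrict S u c = record
    { support      = λ x → support x ∧ not (does (x ≟ u))
    ; fun          = λ a → fun (a [ u ↦ c ])
    ; state        = λ r a → state r (a [ u ↦ c ])
    ; state-prefix = λ r a a′ agree → state-prefix r _ _ (λ x lt → update-cong a a′ u c x (λ _ → agree x lt))
    ; state-suffix = λ r a a′ same agree → state-suffix r _ _ same (λ x ge → update-cong a a′ u c x (λ _ → agree x ge))
    ; state-dead   = λ r a → state-dead r _
    ; fun-support  = λ a a′ agree → fun-support _ _ (λ x Sx → update-cong a a′ u c x
                       (λ x≢u → agree x (∧-intro Sx (not-false (dec-false (x ≟ u) x≢u)))))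
    }
    where open Layered S

  module Quantify {W : ℕ} (S : Layered W) (E : Fin n → Bool) where
    open Layered S

    below : Fin n → Fin n → Bool
    below r x = if does (level x N.<? toℕ r) then E x else false

    below-lt : ∀ r x → level x < toℕ r → below r x ≡ E x
    below-lt r x lt rewrite dec-true (level x N.<? toℕ r) lt = refl

    below-E : ∀ r x → E x ≡ false → below r x ≡ false
    below-E r x Ex with does (level x N.<? toℕ r)
    ... | true  = Ex
    ... | false = refl

    splice-agrees-below : ∀ r a c → AgreeOutside E a c → AgreeOutside (below r) a (splice r c a)
    splice-agrees-below r a c a≈c y By with level y N.<? toℕ r
    ... | yes lt = trans (a≈c y (trans (sym (below-lt r y lt)) By)) (sym (splice-below r c a y lt))
    ... | no ≮  = sym (splice-above r c a y (NP.≮⇒≥ ≮))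

    splice-agrees : ∀ r a a′ c c′ → AgreeOutside (below r) a′ c′ → (∀ x → toℕ r ≤ level x → a x ≡ a′ x) →
      AgreeOutside E a c → AgreeOutside E a′ (splice r c′ c)
    splice-agrees r a a′ c c′ a′≈c′ same-above a≈c y Ey with level y N.<? toℕ r
    ... | yes lt = trans (a′≈c′ y (trans (below-lt r y lt) Ey)) (sym (splice-below r c′ c y lt))
    ... | no ≮ = trans (sym (same-above y (NP.≮⇒≥ ≮))) (trans (a≈c y Ey) (sym (splice-above r c′ c y (NP.≮⇒≥ ≮))))

    exists-below-prefix : ∀ r P → PrefixDependent r P → PrefixDependent r (exists (below r) P)
    exists-below-prefix r P dep a a′ agree =
      exists-dependsOn (below r) (λ x → does (level x N.<? toℕ r)) P
        (λ c c′ same → dep c c′ (λ x lt → same x (dec-true (level x N.<? toℕ r) lt))) a a′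
        (λ x u → agree x (does-true⇒ (level x N.<? toℕ r) (∧-conicalˡ _ _ u)))

    extensional : ∀ r {P} → PrefixDependent r P → Extensional P
    extensional r dep a c same = dep a c (λ x _ → same x)

    exists-below-intro : ∀ r P → PrefixDependent r P → ∀ a c → AgreeOutside E a c → P c ≡ true →
      exists (below r) P a ≡ true
    exists-below-intro r P dep a c a≈c Pc = exists-intro (below r) P (extensional r dep) a (splice r c a)
      (splice-agrees-below r a c a≈c) (trans (dep _ _ (splice-below r c a)) Pc)

    reachable : Fin n → Assignment n → Fin W → Bool
    reachable r a s = exists (below r) (hasState r s) a

    reachable-intro : ∀ r a c s → AgreeOutside E a c → state r c ≡ just s → reachable r a s ≡ true
    reachable-intro r a c s a≈c cs = exists-below-intro r _ (hasState-prefix r s) a c a≈c (dec-true (_ ≟ₛ _) cs)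

    stateSet : Fin n → Assignment n → Fin (2 ^ W)
    stateSet r a = encode W (reachable r a)

    stateSet-prefix : ∀ r → PrefixDependent r (stateSet r)
    stateSet-prefix r a a′ agree =
      encode-cong W _ _ (λ s → exists-below-prefix r (hasState r s) (hasState-prefix r s) a a′ agree)

    transfer : ∀ r a a′ c s → AgreeOutside E a c → state r c ≡ just s → stateSet r a ≡ stateSet r a′ →
      (∀ x → toℕ r ≤ level x → a x ≡ a′ x) → Σ (Assignment n) λ c″ → AgreeOutside E a′ c″ × fun c″ ≡ fun c
    transfer r a a′ c s a≈c cs same-set same-above with exists-sound (below r) (hasState r s) a′
        (trans (sym (encode-injective W _ _ same-set s)) (reachable-intro r a c s a≈c cs))
    ... | c′ , c′s , a′≈c′ = splice r c′ c , splice-agrees r a a′ c c′ a′≈c′ same-above a≈c ,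
      state-suffix r _ c (trans (state-splice r c′ c) (trans (does-true⇒ (_ ≟ₛ _) c′s) (sym cs)))
        (λ x ge → splice-above r c′ c x ge)

    live-prefix : ∀ r → PrefixDependent r (λ c → is-just (state r c))
    live-prefix r a a′ agree = cong is-just (state-prefix r a a′ agree)

    dead-prefix : ∀ r → PrefixDependent r (λ c → not (is-just (state r c)))
    dead-prefix r a a′ agree = cong not (live-prefix r a a′ agree)

    alive : Fin n → Assignment n → Bool
    alive r = exists (below r) (λ c → is-just (state r c))

    alive-intro : ∀ r a c s → AgreeOutside E a c → state r c ≡ just s → alive r a ≡ true
    alive-intro r a c s a≈c cs = exists-below-intro r _ (live-prefix r) a c a≈c (cong is-just cs)

    existsLayered : Layered (2 ^ W)
    existsLayered = record
      { support      = λ x → support x ∧ not (E x)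
      ; fun          = exists E fun
      ; state        = state∃
      ; state-prefix = λ r a a′ agree → cong₂ (λ b v → if b then just v else nothing)
                         (exists-below-prefix r _ (live-prefix r) a a′ agree) (stateSet-prefix r a a′ agree)
      ; state-suffix = λ r a a′ same same-above →
                         bool-ext (witnessed r a a′ same same-above) (witnessed r a′ a (sym same) (λ x ge → sym (same-above x ge)))
      ; state-dead   = dead
      ; fun-support  = exists-dependsOn E support fun fun-support
      }
      where
      state∃ : Fin n → Assignment n → Maybe (Fin (2 ^ W))
      state∃ r a = if alive r a then just (stateSet r a) else nothing

      dead : ∀ r a → state∃ r a ≡ nothing → exists E fun a ≡ false
      dead r a none with exists E fun a in ex
      ... | false = refl
      ... | true with exists-sound E fun a ex
      ...   | c , fc , a≈c with state r c in cs
      ...     | nothing with trans (sym fc) (state-dead r c cs)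
      ...       | ()
      dead r a none | true | c , fc , a≈c | just s with trans (sym (alive-intro r a c s a≈c cs)) (if-nothing _ _ none)
      ...       | ()

      witnessed : ∀ r a a′ → state∃ r a ≡ state∃ r a′ → (∀ x → toℕ r ≤ level x → a x ≡ a′ x) →
        exists E fun a ≡ true → exists E fun a′ ≡ true
      witnessed r a a′ same same-above ex with exists-sound E fun a ex
      ... | c , fc , a≈c with state r c in cs
      ...   | nothing with trans (sym fc) (state-dead r c cs)
      ...     | ()
      witnessed r a a′ same same-above ex | c , fc , a≈c | just s =
        let set-a = cong (λ b → if b then just (stateSet r a) else nothing) (alive-intro r a c s a≈c cs)
            same-set = sym (proj₂ (if-just _ _ _ (trans (sym same) set-a)))
            (c″ , a′≈c″ , fc″) = transfer r a a′ c s a≈c cs same-set same-above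
        in exists-intro E fun (DependsOn⇒Extensional fun-support) a′ c″ a′≈c″ (trans fc″ fc)

    dying : Fin n → Assignment n → Bool
    dying r = exists (below r) (λ c → not (is-just (state r c)))

    dying-intro : ∀ r a c → AgreeOutside E a c → state r c ≡ nothing → dying r a ≡ true
    dying-intro r a c a≈c cs = exists-below-intro r _ (dead-prefix r) a c a≈c (cong (λ m → not (is-just m)) cs)

    refuted : Assignment n → Bool
    refuted = exists E (λ c → not (fun c))

    refuted-ext : Extensional (λ c → not (fun c))
    refuted-ext a c same = cong not (DependsOn⇒Extensional fun-support a c same)

    dying⇒refuted : ∀ r a → dying r a ≡ true → refuted a ≡ true
    dying⇒refuted r a d with exists-sound (below r) _ a d
    ... | c , c-dead , a≈c with state r c in cs
    ...   | nothing = exists-intro E _ refuted-ext a c (λ y Ey → a≈c y (below-E r y Ey)) (not-false (state-dead r c cs))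

    forallLayered : Layered (2 ^ W)
    forallLayered = record
      { support      = λ x → support x ∧ not (E x)
      ; fun          = λ a → not (refuted a)
      ; state        = state∀
      ; state-prefix = λ r a a′ agree → cong₂ (λ b v → if b then just v else nothing)
                         (cong not (exists-below-prefix r _ (dead-prefix r) a a′ agree)) (stateSet-prefix r a a′ agree)
      ; state-suffix = λ r a a′ same same-above → cong not
                         (bool-ext (witnessed r a a′ same same-above)
                                   (witnessed r a′ a (sym same) (λ x ge → sym (same-above x ge))))
      ; state-dead   = λ r a none → cong not (dying⇒refuted r a (not-injective (if-nothing _ _ none)))
      ; fun-support  = λ a a′ agree → cong not
                         (exists-dependsOn E support _ (λ c c′ same → cong not (fun-support c c′ same)) a a′ agree)
      }
      where
      state∀ : Fin n → Assignment n → Maybe (Fin (2 ^ W))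
      state∀ r a = if not (dying r a) then just (stateSet r a) else nothing

      witnessed : ∀ r a a′ → state∀ r a ≡ state∀ r a′ → (∀ x → toℕ r ≤ level x → a x ≡ a′ x) →
        refuted a ≡ true → refuted a′ ≡ true
      witnessed r a a′ same same-above ref with state∀ r a′ in s′
      ... | nothing = dying⇒refuted r a′ (not-injective (if-nothing _ _ s′))
      ... | just v with exists-sound E _ a ref
      ...   | c , nfc , a≈c with state r c in cs
      ...     | nothing with trans (sym (cong not (dying-intro r a c a≈c cs))) (proj₁ (if-just _ _ _ same))
      ...       | ()
      witnessed r a a′ same same-above ref | just v | c , nfc , a≈c | just s =
        let (c″ , a′≈c″ , fc″) = transfer r a a′ c s a≈c cs
              (trans (proj₂ (if-just _ _ _ same)) (sym (proj₂ (if-just _ _ _ s′)))) same-above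
        in exists-intro E _ refuted-ext a′ c″ a′≈c″ (trans (cong not fc″) nfc)

  quantify : Quant → ∀ {W} → Layered W → (Fin n → Bool) → Layered (2 ^ W)
  quantify ∃q S E = Quantify.existsLayered S E
  quantify ∀q S E = Quantify.forallLayered S E

  quantify-support : ∀ q {W} (S : Layered W) E x →
    Layered.support (quantify q S E) x ≡ Layered.support S x ∧ not (E x)
  quantify-support ∃q S E x = refl
  quantify-support ∀q S E x = refl

  quantify-∅ : ∀ q {W} (S : Layered W) E → (∀ y → E y ≡ false) →
    ∀ a → Layered.fun (quantify q S E) a ≡ Layered.fun S a
  quantify-∅ ∃q S E none a = exists-∅ E _ (DependsOn⇒Extensional (Layered.fun-support S)) none a
  quantify-∅ ∀q S E none a = trans (cong not (exists-∅ E _ (Quantify.refuted-ext S E) none a)) (not-involutive _)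

  quantify-split : ∀ q {W} (S : Layered W) E E′ x → (∀ y → E′ y ≡ true → E y ≡ true) →
    (∀ y → E y ≡ true → E′ y ≡ false → y ≡ x) → E x ≡ true → ∀ a →
    Layered.fun (quantify q S E) a ≡
      connective q (Layered.fun (quantify q S E′) (a [ x ↦ false ])) (Layered.fun (quantify q S E′) (a [ x ↦ true ]))
  quantify-split ∃q S E E′ x E′⊆E E∖E′⊆x Ex a =
    exists-split E E′ _ x (DependsOn⇒Extensional (Layered.fun-support S)) E′⊆E E∖E′⊆x Ex a
  quantify-split ∀q S E E′ x E′⊆E E∖E′⊆x Ex a =
    trans (cong not (exists-split E E′ _ x (Quantify.refuted-ext S E) E′⊆E E∖E′⊆x Ex a))
      (not-∨ (Quantify.refuted S E′ (a [ x ↦ false ])) (Quantify.refuted S E′ (a [ x ↦ true ])))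
    where
    not-∨ : ∀ u v → not (u ∨ v) ≡ not u ∧ not v
    not-∨ false v = refl
    not-∨ true  v = refl

  quantify-single : ∀ q {W} (S : Layered W) E x → (∀ y → E y ≡ true → y ≡ x) → E x ≡ true → ∀ a →
    Layered.fun (quantify q S E) a ≡ connective q (Layered.fun S (a [ x ↦ false ])) (Layered.fun S (a [ x ↦ true ]))
  quantify-single q S E x E⊆x Ex a =
    trans (quantify-split q S E (λ _ → false) x (λ _ ()) (λ y Ey _ → E⊆x y Ey) Ex a)
      (cong₂ (connective q) (quantify-∅ q S _ (λ _ → refl) _) (quantify-∅ q S _ (λ _ → refl) _))

module PathOrder (Φ : PCNF) (PD : PathDecomposition Φ) where
  open PathDecomposition PD using (bag; vcover; ecover; contig) renaming (r to numBags)

  inBag : Fin numBags → Fin (n Φ) → Bool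
  inBag i x = V.lookup (bag i) x

  firstBag : Fin (n Φ) → Fin numBags
  firstBag x = fromMaybe (proj₁ (vcover x)) (least (λ i → inBag i x))

  firstBag-∈ : ∀ x → x Sub.∈ bag (firstBag x)
  firstBag-∈ x with least (λ i → inBag i x) in found
  ... | just i = VP.lookup⇒[]= x (bag i) (proj₁ (least-just _ i found))
  ... | nothing with trans (sym (VP.[]=⇒lookup (proj₂ (vcover x)))) (least-nothing _ found (proj₁ (vcover x)))
  ...   | ()

  firstBag-least : ∀ x i → x Sub.∈ bag i → toℕ (firstBag x) ≤ toℕ i
  firstBag-least x i x∈ with least (λ i → inBag i x) in found
  ... | just j = proj₂ (least-just _ j found) i (VP.[]=⇒lookup x∈)
  ... | nothing with trans (sym (VP.[]=⇒lookup x∈)) (least-nothing _ found i)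
  ...   | ()

  key : Fin (n Φ) → ℕ
  key x = toℕ (F.combine (firstBag x) x)

  key-injective : ∀ {x y} → key x ≡ key y → x ≡ y
  key-injective {x} {y} eq = proj₂ (FP.combine-injective (firstBag x) x (firstBag y) y (FP.toℕ-injective eq))

  abstract
    order : Permutation′ (n Φ)
    order = SortBy.sorting key key-injective

    order-sorts : ∀ x y → toℕ (order ⟨$⟩ʳ x) < toℕ (order ⟨$⟩ʳ y) → key x < key y
    order-sorts = SortBy.sorting-sorts key key-injective

  open Layering order public

  firstBag-mono : ∀ x y → level x ≤ level y → toℕ (firstBag x) ≤ toℕ (firstBag y)
  firstBag-mono x y x≤y with NP.m≤n⇒m<n∨m≡n x≤y
  ... | inj₂ x≡y = NP.≤-reflexive (cong (λ z → toℕ (firstBag z)) (level-injective x≡y))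
  ... | inj₁ x<y with NP.<-cmp (toℕ (firstBag y)) (toℕ (firstBag x))
  ...   | tri< fy<fx _ _ = ⊥-elim (NP.<-asym (order-sorts x y x<y) (FP.combine-monoˡ-< y x fy<fx))
  ...   | tri≈ _ fy≡fx _ = NP.≤-reflexive (sym fy≡fx)
  ...   | tri> _ _ fy>fx = NP.<⇒≤ fy>fx

  clause : Fin (m Φ) → Clause (n Φ)
  clause c = V.lookup (clauses Φ) c

  -- where pathwidth enters: a clause straddling level r keeps its early variables in one bag
  straddling-∈-bag : ∀ r c x y → x ∈ vars (clause c) → y ∈ vars (clause c) → level x < toℕ r → toℕ r ≤ level y →
    x Sub.∈ bag (firstBag (varAt r))
  straddling-∈-bag r c x y x∈ y∈ x<r r≤y =
    contig x (firstBag x) (firstBag (varAt r)) i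
      (firstBag-mono x (varAt r) (subst (level x ≤_) (sym (level-varAt r)) (NP.<⇒≤ x<r)))
      (NP.≤-trans (firstBag-mono (varAt r) y (subst (_≤ level y) (sym (level-varAt r)) r≤y))
        (firstBag-least y i (proj₂ (proj₂ shared))))
      (firstBag-∈ x) (proj₁ (proj₂ shared))
    where
    x≢y : x ≢ y
    x≢y refl = NP.<-irrefl refl (NP.<-≤-trans x<r r≤y)
    shared = ecover x y (x≢y , c , x∈ , y∈)
    i = proj₁ shared

  module Clauses (k : ℕ) (narrow : WidthAtMost PD k) (selected : Fin (m Φ) → Bool) where

    violated : Assignment (n Φ) → Fin (m Φ) → Bool
    violated a c = selected c ∧ not (evalClause a (clause c))

    satisfied : Assignment (n Φ) → Bool
    satisfied a = not (anyTrue (violated a))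

    satisfied-sound : ∀ a c → satisfied a ≡ true → selected c ≡ true → evalClause a (clause c) ≡ true
    satisfied-sound a c sat sc with evalClause a (clause c) in ev
    ... | true = refl
    ... | false with trans (sym (cong not (anyTrue-intro (violated a) c (∧-intro sc (not-false ev))))) sat
    ...   | ()

    satisfied-intro : ∀ a → (∀ c → selected c ≡ true → evalClause a (clause c) ≡ true) → satisfied a ≡ true
    satisfied-intro a sat with anyTrue (violated a) in any
    ... | false = refl
    ... | true with anyTrue-sound (violated a) any
    ...   | c , v with trans (sym (sat c (∧-conicalˡ _ _ v))) (not-injective (∧-conicalʳ _ _ v))
    ...     | ()

    settled : Fin (n Φ) → Fin (m Φ) → Bool
    settled r c = does (All.all? (λ x → level x N.<? toℕ r) (vars (clause c)))

    violatedBelow : Fin (n Φ) → Assignment (n Φ) → Fin (m Φ) → Bool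
    violatedBelow r a c = selected c ∧ (settled r c ∧ not (evalClause a (clause c)))

    violatedBelow-prefix : ∀ r c → PrefixDependent r (λ a → violatedBelow r a c)
    violatedBelow-prefix r c a a′ agree with All.all? (λ x → level x N.<? toℕ r) (vars (clause c))
    ... | yes below = cong (λ v → selected c ∧ not v)
                        (evalClause-cong (clause c) a a′ (λ x x∈ → agree x (All.lookup below x∈)))
    ... | no _ = refl

    dead : Fin (n Φ) → Assignment (n Φ) → Bool
    dead r a = anyTrue (violatedBelow r a)

    dead⇒unsatisfied : ∀ r a → dead r a ≡ true → satisfied a ≡ false
    dead⇒unsatisfied r a d with anyTrue-sound _ d
    ... | c , v = cong not (anyTrue-intro (violated a) c
                    (∧-intro (∧-conicalˡ (selected c) _ v) (∧-conicalʳ (settled r c) _ (∧-conicalʳ (selected c) _ v))))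

    alive-satisfies : ∀ r a c → dead r a ≡ false → selected c ≡ true → settled r c ≡ true →
      evalClause a (clause c) ≡ true
    alive-satisfies r a c alive sc st with evalClause a (clause c) in ev
    ... | true = refl
    ... | false with trans (sym (anyTrue-intro (violatedBelow r a) c (∧-intro sc (∧-intro st (not-false ev))))) alive
    ...   | ()

    activeAt : Fin (n Φ) → Subset (n Φ)
    activeAt r = subset (λ x → inBag (firstBag (varAt r)) x ∧ does (level x N.<? toℕ r))

    active-below : ∀ r x → x Sub.∈ activeAt r → level x < toℕ r
    active-below r x x∈ = does-true⇒ (level x N.<? toℕ r) (∧-conicalʳ _ _ (∈-subset⁻ _ x∈))

    active-size : ∀ r → Sub.∣ activeAt r ∣ ≤ k
    active-size r = NP.≤-pred (NP.<-≤-trans (p⊂q⇒∣p∣<∣q∣ (⊆bag , varAt r , firstBag-∈ (varAt r) , current∉))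
                                            (narrow (firstBag (varAt r))))
      where
      ⊆bag : activeAt r Sub.⊆ bag (firstBag (varAt r))
      ⊆bag x∈ = VP.lookup⇒[]= _ _ (∧-conicalˡ _ _ (∈-subset⁻ _ x∈))
      current∉ : varAt r Sub.∉ activeAt r
      current∉ ∈a = NP.<-irrefl (level-varAt r) (active-below r (varAt r) ∈a)

    code : Fin (n Φ) → Assignment (n Φ) → Fin (2 ^ k)
    code r a = F.inject≤ (encodeOn (activeAt r) a) (NP.^-monoʳ-≤ 2 (active-size r))

    code-injective : ∀ r a a′ → code r a ≡ code r a′ → ∀ x → x Sub.∈ activeAt r → a x ≡ a′ x
    code-injective r a a′ eq = encodeOn-injective (activeAt r) a a′ (FP.inject≤-injective _ _ _ _ eq)

    state : Fin (n Φ) → Assignment (n Φ) → Maybe (Fin (2 ^ k))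
    state r a = if not (dead r a) then just (code r a) else nothing

    state-prefix : ∀ r → PrefixDependent r (state r)
    state-prefix r a a′ agree = cong₂ (λ b v → if not b then just v else nothing)
      (anyTrue-cong _ _ (λ c → violatedBelow-prefix r c a a′ agree))
      (cong (λ i → F.inject≤ i (NP.^-monoʳ-≤ 2 (active-size r)))
        (encodeOn-cong (activeAt r) a a′ (λ x x∈ → agree x (active-below r x x∈))))

    state-suffix : ∀ r a a′ → state r a ≡ state r a′ → (∀ x → toℕ r ≤ level x → a x ≡ a′ x) →
                   satisfied a ≡ satisfied a′
    state-suffix r a a′ same same-above with dead r a in da | dead r a′ in da′
    ... | true  | true  = trans (dead⇒unsatisfied r a da) (sym (dead⇒unsatisfied r a′ da′))
    ... | false | false = cong not (anyTrue-cong _ _ same-violated)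
      where
      same-code : code r a ≡ code r a′
      same-code = proj₂ (if-just true (code r a) (code r a′) same)
      same-violated : ∀ c → violated a c ≡ violated a′ c
      same-violated c with selected c in sc | All.all? (λ x → level x N.<? toℕ r) (vars (clause c)) in st
      ... | false | _ = refl
      ... | true | yes _ = cong not (trans (alive-satisfies r a c da sc (cong does st))
                                         (sym (alive-satisfies r a′ c da′ sc (cong does st))))
      ... | true | no unsettled with find (¬All⇒Any¬ (λ x → level x N.<? toℕ r) _ unsettled)
      ...   | y , y∈ , y≮r = cong not (evalClause-cong (clause c) a a′ agree)
        where
        agree : ∀ x → x ∈ vars (clause c) → a x ≡ a′ x
        agree x x∈ with level x N.<? toℕ r
        ... | yes x<r = code-injective r a a′ same-code x
                          (∈-subset⁺ _ (∧-intro (VP.[]=⇒lookup (straddling-∈-bag r c x y x∈ y∈ x<r (NP.≮⇒≥ y≮r)))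
                                                (dec-true (level x N.<? toℕ r) x<r)))
        ... | no x≮r = same-above x (NP.≮⇒≥ x≮r)

    layered : Layered (2 ^ k)
    layered = record
      { support      = λ _ → true
      ; fun          = satisfied
      ; state        = state
      ; state-prefix = state-prefix
      ; state-suffix = state-suffix
      ; state-dead   = λ r a none → dead⇒unsatisfied r a (not-injective (if-nothing _ _ none))
      ; fun-support  = λ a a′ agree → cong not (anyTrue-cong _ _ (λ c → cong (λ v → selected c ∧ not v)
                         (evalClause-cong (clause c) a a′ (λ x _ → agree x refl))))
      }

n<2^n : ∀ x → x < 2 ^ x
n<2^n zero    = s≤s z≤n
n<2^n (suc x) = NP.+-mono-≤ (NP.m^n>0 2 x) (subst (suc x ≤_) (sym (NP.+-identityʳ (2 ^ x))) (n<2^n x))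

tower-mono : ∀ k {i j} → i ≤ j → tower k i ≤ tower k j
tower-mono k {zero}  {zero}  _ = NP.≤-refl
tower-mono k {zero}  {suc j} _ = NP.≤-trans (tower-mono k {zero} {j} z≤n) (NP.<⇒≤ (n<2^n (tower k j)))
tower-mono k {suc i} {suc j} (s≤s i≤j) = NP.^-monoʳ-≤ 2 (tower-mono k i≤j)

blocks-cons : ∀ {l} q (qs : Vec Quant l) → blocks qs ≤ blocks (q V.∷ qs)
blocks-cons q V.[] = z≤n
blocks-cons q (q′ V.∷ qs) with sameQ q q′
... | true  = NP.≤-refl
... | false = NP.n≤1+n _

sameQ-sound : ∀ q q′ → sameQ q q′ ≡ true → q ≡ q′
sameQ-sound ∃q ∃q _ = refl
sameQ-sound ∀q ∀q _ = refl

QuantifiersFrom : (Φ : PCNF) → ℕ → ∀ {l} → Vec Quant l → Set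
QuantifiersFrom Φ t {l} qs = ∀ (i : Fin l) x → toℕ x ≡ t + toℕ i → Q Φ x ≡ V.lookup qs i

data PrefixView (Φ : PCNF) : Set where
  empty    : n Φ ≡ 0 → PrefixView Φ
  nonempty : ∀ {l} q (qs : Vec Quant l) → suc l ≡ n Φ → blocks (prefix Φ) ≡ blocks (q V.∷ qs) →
             QuantifiersFrom Φ 0 (q V.∷ qs) → PrefixView Φ

prefixView : ∀ Φ → PrefixView Φ
prefixView record { n = zero ; prefix = V.[] } = empty refl
prefixView record { n = suc l ; prefix = q V.∷ qs } =
  nonempty q qs refl refl (λ i x eq → cong (V.lookup (q V.∷ qs)) (FP.toℕ-injective eq))

module Strategy (Φ : PCNF) (σ : UStrategy Φ) where
  open UStrategy σ

  ConsistentBelow : ℕ → Assignment (n Φ) → Set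
  ConsistentBelow t a = ∀ u → Q Φ u ≡ ∀q → toℕ u < t → a u ≡ f u a

  Refuted : ℕ → (Assignment (n Φ) → Bool) → Set
  Refuted t g = ∀ a → ConsistentBelow t a → g a ≡ false

  consistent-update : ∀ x a b → ConsistentBelow (toℕ x) a → ∀ u → Q Φ u ≡ ∀q → toℕ u < toℕ x →
    (a [ x ↦ b ]) u ≡ f u (a [ x ↦ b ])
  consistent-update x a b consistent u ∀u u<x =
    trans (update-other a x b u (λ u≡x → NP.<-irrefl (cong toℕ u≡x) u<x))
      (trans (consistent u ∀u u<x)
        (local u a (a [ x ↦ b ]) (λ i i<u → sym (update-other a x b i
          (λ i≡x → NP.<-asym (subst (_< toℕ u) (cong toℕ i≡x) i<u) u<x)))))

  consistent-extend : ∀ x a b → ConsistentBelow (toℕ x) a → (Q Φ x ≡ ∀q → b ≡ f x a) →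
    ConsistentBelow (suc (toℕ x)) (a [ x ↦ b ])
  consistent-extend x a b consistent chosen u ∀u u<sx with NP.m≤n⇒m<n∨m≡n (NP.≤-pred u<sx)
  ... | inj₁ u<x = consistent-update x a b consistent u ∀u u<x
  ... | inj₂ u≡x with FP.toℕ-injective u≡x
  ...   | refl = trans (update-same a u b) (trans (chosen ∀u) (local u a (a [ u ↦ b ])
                   (λ i i<u → sym (update-other a u b i (λ i≡u → NP.<-irrefl (cong toℕ i≡u) i<u)))))

  refuted-step : ∀ x (g g′ : Assignment (n Φ) → Bool) →
    (∀ a → g a ≡ connective (Q Φ x) (g′ (a [ x ↦ false ])) (g′ (a [ x ↦ true ]))) →
    Refuted (suc (toℕ x)) g′ → Refuted (toℕ x) g
  refuted-step x g g′ splits refuted a consistent = trans (splits a) (by-quantifier (Q Φ x) refl)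
    where
    side : ∀ b → (Q Φ x ≡ ∀q → b ≡ f x a) → g′ (a [ x ↦ b ]) ≡ false
    side b chosen = refuted _ (consistent-extend x a b consistent chosen)
    by-quantifier : ∀ q → Q Φ x ≡ q → connective q (g′ (a [ x ↦ false ])) (g′ (a [ x ↦ true ])) ≡ false
    by-quantifier ∃q ∃x = cong₂ _∨_ (side false (λ ∀x → ⊥-∃∀ (trans (sym ∃x) ∀x)))
                                     (side true (λ ∀x → ⊥-∃∀ (trans (sym ∃x) ∀x)))
      where
      ⊥-∃∀ : ∀ {A : Set} → ∃q ≡ ∀q → A
      ⊥-∃∀ ()
    by-quantifier ∀q ∀x with f x a in chosen
    ... | false = cong (_∧ g′ (a [ x ↦ true ])) (side false (λ _ → sym chosen))
    ... | true  = trans (cong (g′ (a [ x ↦ false ]) ∧_) (side true (λ _ → sym chosen))) (∧-zeroʳ _)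

  play : ℕ → Assignment (n Φ)
  play zero    x = false
  play (suc j) x = if does (toℕ x N.≟ j) then f x (play j) else play j x

  play-frozen : ∀ d j x → toℕ x < j → play (d + j) x ≡ play j x
  play-frozen zero    j x x<j = refl
  play-frozen (suc d) j x x<j
    rewrite dec-false (toℕ x N.≟ d + j) (λ eq → NP.<⇒≱ x<j (NP.≤-trans (NP.m≤n+m j d) (NP.≤-reflexive (sym eq))))
    = play-frozen d j x x<j

  play-settled : ∀ j x → toℕ x < j → play j x ≡ f x (play (toℕ x))
  play-settled j x x<j rewrite sym (NP.m∸n+n≡m x<j) | play-frozen (j ∸ suc (toℕ x)) (suc (toℕ x)) x NP.≤-refl
                             | dec-true (toℕ x N.≟ toℕ x) refl = refl

  play-consistent : ∀ u → play (n Φ) u ≡ f u (play (n Φ))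
  play-consistent u = trans (play-settled (n Φ) u (FP.toℕ<n u)) (local u _ _ agree)
    where
    agree : ∀ i → i F.< u → play (toℕ u) i ≡ play (n Φ) i
    agree i i<u = trans (play-settled (toℕ u) i i<u) (sym (play-settled (n Φ) i (FP.toℕ<n i)))

  has-clause : Winning Φ σ → 0 < m Φ
  has-clause win = NP.≤-trans (s≤s z≤n) (FP.toℕ<n (proj₁ (win (play (n Φ)) (λ u _ → play-consistent u))))

sumFin-≤ : ∀ r (f : Fin r → ℕ) B → (∀ i → f i ≤ B) → sumFin r f ≤ r * B
sumFin-≤ zero    f B f≤B = z≤n
sumFin-≤ (suc r) f B f≤B = NP.+-mono-≤ (f≤B F.zero) (sumFin-≤ r (λ i → f (F.suc i)) B (λ i → f≤B (F.suc i)))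

lookup-∷ʳ-inject₁ : ∀ {A : Set} {len} (xs : Vec A len) y i → V.lookup (xs ∷ʳ y) (F.inject₁ i) ≡ V.lookup xs i
lookup-∷ʳ-inject₁ (x V.∷ xs) y F.zero    = refl
lookup-∷ʳ-inject₁ (x V.∷ xs) y (F.suc i) = lookup-∷ʳ-inject₁ xs y i

lookup-∷ʳ-last : ∀ {A : Set} {len} (xs : Vec A len) y → V.lookup (xs ∷ʳ y) (F.fromℕ len) ≡ y
lookup-∷ʳ-last V.[]       y = refl
lookup-∷ʳ-last (x V.∷ xs) y = lookup-∷ʳ-last xs y

inject₁-or-last : ∀ {len} (i : Fin (suc len)) → (Σ (Fin len) λ j → i ≡ F.inject₁ j) ⊎ i ≡ F.fromℕ len
inject₁-or-last {zero}  F.zero = inj₂ refl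
inject₁-or-last {suc len} F.zero = inj₁ (F.zero , refl)
inject₁-or-last {suc len} (F.suc i) with inject₁-or-last i
... | inj₁ (j , eq) = inj₁ (F.suc j , cong F.suc eq)
... | inj₂ eq = inj₂ (cong F.suc eq)

inject₁-< : ∀ {len} {i j : Fin len} → i F.< j → F.inject₁ i F.< F.inject₁ j
inject₁-< {i = i} {j} i<j = subst₂ _<_ (sym (FP.toℕ-inject₁ i)) (sym (FP.toℕ-inject₁ j)) i<j

inject₁-<-last : ∀ {len} (i : Fin len) → F.inject₁ i F.< F.fromℕ len
inject₁-<-last {len} i = subst₂ _<_ (sym (FP.toℕ-inject₁ i)) (sym (FP.toℕ-fromℕ len)) (FP.toℕ<n i)

module Derivations (Φ : PCNF) (π : Permutation′ (n Φ)) (B : ℕ) where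

  Line : Set
  Line = OBDD (n Φ) π

  justified-∷ʳ : ∀ {len} (ls : Vec Line len) L i → Justified Φ π (V.lookup ls) i →
    Justified Φ π (V.lookup (ls ∷ʳ L)) (F.inject₁ i)
  justified-∷ʳ ls L i (inj₁ (c , c≡i , rep)) =
    inj₁ (c , trans c≡i (sym (FP.toℕ-inject₁ i)) , subst (λ L′ → Represents L′ _) (sym (lookup-∷ʳ-inject₁ ls L i)) rep)
  justified-∷ʳ ls L i (inj₂ (m≤i , inference)) = inj₂ (subst (m Φ ≤_) (sym (FP.toℕ-inject₁ i)) m≤i , lift inference)
    where
    old = lookup-∷ʳ-inject₁ ls L
    rep : ∀ j {f} → Represents (V.lookup ls j) f → Represents (V.lookup (ls ∷ʳ L) (F.inject₁ j)) f
    rep j = subst (λ L′ → Represents L′ _) (sym (old j))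
    lift : Inference Φ π (V.lookup ls) i → Inference Φ π (V.lookup (ls ∷ʳ L)) (F.inject₁ i)
    lift (conj j j′ j<i j′<i f g rf rg ri) = conj _ _ (inject₁-< j<i) (inject₁-< j′<i) f g (rep j rf) (rep j′ rg) (rep i ri)
    lift (proj j j<i x xv f rf ri) = proj _ (inject₁-< j<i) x (subst (λ L′ → VarOf L′ x) (sym (old j)) xv) f (rep j rf) (rep i ri)
    lift (ured j j<i u ∀u uv maximal c f rf ri) =
      ured _ (inject₁-< j<i) u ∀u (subst (λ L′ → VarOf L′ u) (sym (old j)) uv)
        (λ v vv → maximal v (subst (λ L′ → VarOf L′ v) (old j) vv)) c f (rep j rf) (rep i ri)

  record Partial (len : ℕ) : Set where
    field
      lines     : Vec Line len
      axioms    : m Φ ≤ len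
      justified : ∀ i → Justified Φ π (V.lookup lines) i
      bounded   : ∀ i → size (V.lookup lines i) ≤ B

    line : Fin len → Line
    line = V.lookup lines

  represents-≗ : ∀ {L : Line} {f g} → Represents L f → (∀ a → f a ≡ g a) → Represents L g
  represents-≗ {L} rf f≗g a = subst (Eval L a F.zero) (f≗g a) (rf a)

  axiom-represents : ∀ {len} (P : Partial len) c →
    Represents (Partial.line P (F.fromℕ< (NP.<-≤-trans (FP.toℕ<n c) (Partial.axioms P))))
               (λ a → evalClause a (V.lookup (clauses Φ) c))
  axiom-represents P c with Partial.justified P (F.fromℕ< (NP.<-≤-trans (FP.toℕ<n c) (Partial.axioms P)))
  ... | inj₁ (c′ , c′≡i , rep) = subst (λ d → Represents _ (λ a → evalClause a (V.lookup (clauses Φ) d)))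
                                   (FP.toℕ-injective (trans c′≡i (FP.toℕ-fromℕ< _))) rep
  ... | inj₂ (m≤i , _) = ⊥-elim (NP.<⇒≱ (FP.toℕ<n c) (subst (m Φ ≤_) (FP.toℕ-fromℕ< _) m≤i))

  refutation : ∀ {len} (P : Partial len) last → suc (toℕ last) ≡ len → Represents (Partial.line P last) (λ _ → false) →
    Σ (Derivation Φ π) λ D → IsRefutation Φ π D × derivationSize Φ π D ≤ len * B
  refutation {len} P last is-last rep =
    record { len = len ; line = line ; hasAxioms = axioms ; justified = justified } ,
    (last , is-last , rep) , sumFin-≤ len (λ i → size (line i)) B bounded
    where open Partial P

  Follows : ∀ {len} → Vec Line len → Line → Set
  Follows {len} ls L = Inference Φ π (V.lookup (ls ∷ʳ L)) (F.fromℕ len)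

  extend : ∀ {len} (P : Partial len) L → size L ≤ B → Follows (Partial.lines P) L → Partial (suc len)
  extend {len} P L L≤B follows = record
    { lines     = lines ∷ʳ L
    ; axioms    = NP.m≤n⇒m≤1+n axioms
    ; justified = justified′
    ; bounded   = bounded′
    }
    where
    open Partial P
    justified′ : ∀ i → Justified Φ π (V.lookup (lines ∷ʳ L)) i
    justified′ i with inject₁-or-last i
    ... | inj₁ (j , refl) = justified-∷ʳ lines L j (justified j)
    ... | inj₂ refl = inj₂ (subst (m Φ ≤_) (sym (FP.toℕ-fromℕ len)) axioms , follows)
    bounded′ : ∀ i → size (V.lookup (lines ∷ʳ L) i) ≤ B
    bounded′ i with inject₁-or-last i
    ... | inj₁ (j , refl) = subst (λ L′ → size L′ ≤ B) (sym (lookup-∷ʳ-inject₁ lines L j)) (bounded j)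
    ... | inj₂ refl = subst (λ L′ → size L′ ≤ B) (sym (lookup-∷ʳ-last lines L)) L≤B

  module _ {len : ℕ} (ls : Vec Line len) (L : Line) where
    private
      old : ∀ j {f} → Represents (V.lookup ls j) f → Represents (V.lookup (ls ∷ʳ L) (F.inject₁ j)) f
      old j = subst (λ L′ → Represents L′ _) (sym (lookup-∷ʳ-inject₁ ls L j))
      new : ∀ {f} → Represents L f → Represents (V.lookup (ls ∷ʳ L) (F.fromℕ len)) f
      new = subst (λ L′ → Represents L′ _) (sym (lookup-∷ʳ-last ls L))
      varOf : ∀ j {x} → VarOf (V.lookup ls j) x → VarOf (V.lookup (ls ∷ʳ L) (F.inject₁ j)) x
      varOf j = subst (λ L′ → VarOf L′ _) (sym (lookup-∷ʳ-inject₁ ls L j))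

    by-conj : ∀ j j′ f g → Represents (V.lookup ls j) f → Represents (V.lookup ls j′) g →
      Represents L (λ a → f a ∧ g a) → Follows ls L
    by-conj j j′ f g rf rg rL = conj _ _ (inject₁-<-last j) (inject₁-<-last j′) f g (old j rf) (old j′ rg) (new rL)

    by-proj : ∀ j x → VarOf (V.lookup ls j) x → ∀ f → Represents (V.lookup ls j) f →
      Represents L (λ a → f (a [ x ↦ false ]) ∨ f (a [ x ↦ true ])) → Follows ls L
    by-proj j x xv f rf rL = proj _ (inject₁-<-last j) x (varOf j xv) f (old j rf) (new rL)

    by-ured : ∀ j u → Q Φ u ≡ ∀q → VarOf (V.lookup ls j) u → (∀ v → VarOf (V.lookup ls j) v → v F.≤ u) →
      ∀ c f → Represents (V.lookup ls j) f → Represents L (λ a → f (a [ u ↦ c ])) → Follows ls L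
    by-ured j u ∀u uv maximal c f rf rL =
      ured _ (inject₁-<-last j) u ∀u (varOf j uv)
        (λ v vv → maximal v (subst (λ L′ → VarOf L′ v) (lookup-∷ʳ-inject₁ ls L j) vv)) c f (old j rf) (new rL)

record System {n : ℕ} (π : Permutation′ n) : Set where
  constructor system
  field
    exponent : ℕ
    layered  : Layering.Layered π (2 ^ exponent)

  open Layering.Layered layered public

  width : ℕ
  width = 2 ^ exponent

module Deriving (Φ : PCNF) (PD : PathDecomposition Φ) (k : ℕ) (narrow : WidthAtMost PD k)
              (T : ℕ) (2^k≤T : 2 ^ k ≤ T) where
  open PathOrder Φ PD
  open Derivations Φ order (3 + n Φ * T)
  open System

  diagramOf : System order → Line
  diagramOf S = ToOBDD.diagram (layered S)

  diagramOf-size : ∀ S → width S ≤ T → size (diagramOf S) ≤ 3 + n Φ * T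
  diagramOf-size S w≤T = NP.+-monoʳ-≤ 3 (NP.*-monoʳ-≤ (n Φ) w≤T)

  diagramOf-represents : ∀ S → Represents (diagramOf S) (fun S)
  diagramOf-represents S = ToOBDD.represents (layered S)

  record Derived (S : System order) : Set where
    field
      len          : ℕ
      partial      : Partial len
      last         : Fin len
      last-is-last : suc (toℕ last) ≡ len
      last-line    : Partial.line partial last ≡ diagramOf S

    lines : Vec Line len
    lines = Partial.lines partial

    represents : Represents (V.lookup lines last) (fun S)
    represents = subst (λ L → Represents L (fun S)) (sym last-line) (diagramOf-represents S)

    varOf-support : ∀ x → VarOf (V.lookup lines last) x → support S x ≡ true
    varOf-support x xv = ToOBDD.varOf-support (layered S) x (subst (λ L → VarOf L x) last-line xv)

    support-varOf : ∀ x → support S x ≡ true → VarOf (V.lookup lines last) x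
    support-varOf x Sx = subst (λ L → VarOf L x) (sym last-line)
      (ToOBDD.support-varOf (layered S) x Sx (F.fromℕ< (NP.m^n>0 2 (exponent S))))

  derive : ∀ {len} (P : Partial len) S → width S ≤ T → Follows (Partial.lines P) (diagramOf S) → Derived S
  derive {len} P S w≤T follows = record
    { len          = suc len
    ; partial      = extend P (diagramOf S) (diagramOf-size S w≤T) follows
    ; last         = F.fromℕ len
    ; last-is-last = cong suc (FP.toℕ-fromℕ len)
    ; last-line    = lookup-∷ʳ-last (Partial.lines P) (diagramOf S)
    }

  clausesWhere : (Fin (m Φ) → Bool) → System order
  clausesWhere selected = system k (Clauses.layered k narrow selected)

  clausesWhere-fun : ∀ selected a →
    (fun (clausesWhere selected) a ≡ true) ⇔ (∀ c → selected c ≡ true → evalClause a (clause c) ≡ true)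
  clausesWhere-fun selected a = mk⇔ (λ sat c → Clauses.satisfied-sound k narrow selected a c sat)
                                    (Clauses.satisfied-intro k narrow selected a)

  clauseSystem : Fin (m Φ) → System order
  clauseSystem c = clausesWhere (λ c′ → does (c′ ≟ c))

  clauseSystem-fun : ∀ c a → fun (clauseSystem c) a ≡ evalClause a (clause c)
  clauseSystem-fun c a = bool-ext
    (λ sat → Equivalence.to (clausesWhere-fun _ a) sat c (dec-true (c ≟ c) refl))
    (λ Cc → Equivalence.from (clausesWhere-fun _ a)
              (λ c′ sel → subst (λ d → evalClause a (clause d) ≡ true) (sym (does-true⇒ (c′ ≟ c) sel)) Cc))

  axioms : Partial (m Φ)
  axioms = record
    { lines     = V.tabulate axiom
    ; axioms    = NP.≤-refl
    ; justified = λ c → inj₁ (c , refl , subst (λ L → Represents L _) (sym (VP.lookup∘tabulate axiom c))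
                                              (represents-≗ (diagramOf-represents (clauseSystem c)) (clauseSystem-fun c)))
    ; bounded   = λ c → subst (λ L → size L ≤ _) (sym (VP.lookup∘tabulate axiom c))
                              (diagramOf-size (clauseSystem c) 2^k≤T)
    }
    where
    axiom : Fin (m Φ) → Line
    axiom c = diagramOf (clauseSystem c)

  clausesBefore : ℕ → System order
  clausesBefore j = clausesWhere (λ c → does (toℕ c N.<? j))

  clausesBefore-zero : ∀ a → fun (clausesBefore 0) a ≡ true
  clausesBefore-zero a = Equivalence.from (clausesWhere-fun _ a) (λ c c<0 → ⊥-elim (NP.n≮0 (does-true⇒ (toℕ c N.<? 0) c<0)))

  clausesBefore-suc : ∀ j c → toℕ c ≡ j → ∀ a →
    fun (clausesBefore (suc j)) a ≡ fun (clausesBefore j) a ∧ evalClause a (clause c)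
  clausesBefore-suc j c c≡j a = bool-ext split join
    where
    all-before : ∀ {i} → fun (clausesBefore i) a ≡ true → ∀ c′ → toℕ c′ < i → evalClause a (clause c′) ≡ true
    all-before sat c′ lt = Equivalence.to (clausesWhere-fun _ a) sat c′ (dec-true (toℕ c′ N.<? _) lt)
    split : fun (clausesBefore (suc j)) a ≡ true → fun (clausesBefore j) a ∧ evalClause a (clause c) ≡ true
    split sat = ∧-intro (Equivalence.from (clausesWhere-fun _ a)
                           (λ c′ lt → all-before sat c′ (NP.m<n⇒m<1+n (does-true⇒ (toℕ c′ N.<? j) lt))))
                        (all-before sat c (s≤s (NP.≤-reflexive c≡j)))
    join : fun (clausesBefore j) a ∧ evalClause a (clause c) ≡ true → fun (clausesBefore (suc j)) a ≡ true
    join both = Equivalence.from (clausesWhere-fun _ a) pick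
      where
      pick : ∀ c′ → does (toℕ c′ N.<? suc j) ≡ true → evalClause a (clause c′) ≡ true
      pick c′ lt with NP.m≤n⇒m<n∨m≡n (NP.≤-pred (does-true⇒ (toℕ c′ N.<? suc j) lt))
      ... | inj₁ c′<j = all-before (∧-conicalˡ _ _ both) c′ c′<j
      ... | inj₂ c′≡j = subst (λ d → evalClause a (clause d) ≡ true)
                          (FP.toℕ-injective (trans c≡j (sym c′≡j))) (∧-conicalʳ _ _ both)

  conjunction : ∀ j → suc j ≤ m Φ → Σ (Derived (clausesBefore (suc j))) λ D → Derived.len D ≡ m Φ + suc j
  conjunction zero 1≤m =
    derive axioms (clausesBefore 1) 2^k≤T
      (by-conj (Partial.lines axioms) (diagramOf (clausesBefore 1)) i₀ i₀ _ _ rep₀ rep₀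
        (represents-≗ (diagramOf-represents (clausesBefore 1))
          (λ a → trans (clausesBefore-suc 0 c₀ (FP.toℕ-fromℕ< 1≤m) a)
                   (trans (cong (_∧ evalClause a (clause c₀)) (clausesBefore-zero a)) (sym (∧-idem _)))))) ,
    NP.+-comm 1 (m Φ)
    where
    c₀ = F.fromℕ< 1≤m
    i₀ = F.fromℕ< (NP.<-≤-trans (FP.toℕ<n c₀) NP.≤-refl)
    rep₀ = axiom-represents axioms c₀
  conjunction (suc j) sj<m with conjunction j (NP.<⇒≤ sj<m)
  ... | D , len≡ =
    derive (Derived.partial D) (clausesBefore (suc (suc j))) 2^k≤T
      (by-conj (Derived.lines D) (diagramOf (clausesBefore (suc (suc j)))) (Derived.last D) i _ _ (Derived.represents D)
        (axiom-represents (Derived.partial D) c)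
        (represents-≗ (diagramOf-represents (clausesBefore (suc (suc j)))) (clausesBefore-suc (suc j) c (FP.toℕ-fromℕ< sj<m)))) ,
    trans (cong suc len≡) (sym (NP.+-suc (m Φ) (suc j)))
    where
    c = F.fromℕ< sj<m
    i = F.fromℕ< (NP.<-≤-trans (FP.toℕ<n c) (Partial.axioms (Derived.partial D)))

  Splits : System order → System order → Fin (n Φ) → Set
  Splits S S′ x = ∀ a → fun S a ≡ connective (Q Φ x) (fun S′ (a [ x ↦ false ])) (fun S′ (a [ x ↦ true ]))

  splits-by : ∀ {S S′} q x → Q Φ x ≡ q →
    (∀ a → fun S a ≡ connective q (fun S′ (a [ x ↦ false ])) (fun S′ (a [ x ↦ true ]))) → Splits S S′ x
  splits-by q x Qx split a rewrite Qx = split a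

  restricted : System order → Fin (n Φ) → Bool → System order
  restricted S x c = system (exponent S) (restrict (layered S) x c)

  eliminate : ∀ {S S′} x (D : Derived S′) → support S′ x ≡ true → (∀ v → support S′ v ≡ true → v F.≤ x) →
    width S ≤ T → width S′ ≤ T → Splits S S′ x → Σ (Derived S) λ D′ → Derived.len D′ ≤ 3 + Derived.len D
  eliminate {S} {S′} x D S′x maximal wS wS′ splits with Q Φ x in qx
  ... | ∃q = derive (Derived.partial D) S wS
               (by-proj (Derived.lines D) _ (Derived.last D) x (Derived.support-varOf D x S′x) (fun S′) (Derived.represents D)
                 (represents-≗ (diagramOf-represents S) splits)) ,
             NP.m≤n+m _ 2
  ... | ∀q = D₂ , NP.≤-refl
    where
    j = Derived.last D
    maximal′ : ∀ v → VarOf (V.lookup (Derived.lines D) j) v → v F.≤ x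
    maximal′ v vv = maximal v (Derived.varOf-support D v vv)
    D₀ = derive (Derived.partial D) (restricted S′ x false) wS′
           (by-ured (Derived.lines D) _ j x qx (Derived.support-varOf D x S′x) maximal′ false (fun S′) (Derived.represents D)
             (diagramOf-represents (restricted S′ x false)))
    j₀ = F.inject₁ j
    still-j : V.lookup (Derived.lines D₀) j₀ ≡ V.lookup (Derived.lines D) j
    still-j = lookup-∷ʳ-inject₁ (Derived.lines D) _ j
    D₁ = derive (Derived.partial D₀) (restricted S′ x true) wS′
           (by-ured (Derived.lines D₀) _ j₀ x qx (subst (λ L → VarOf L x) (sym still-j) (Derived.support-varOf D x S′x))
             (λ v vv → maximal′ v (subst (λ L → VarOf L v) still-j vv)) true (fun S′)
             (subst (λ L → Represents L (fun S′)) (sym still-j) (Derived.represents D))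
             (diagramOf-represents (restricted S′ x true)))
    D₂ = derive (Derived.partial D₁) S wS
           (by-conj (Derived.lines D₁) _ (F.inject₁ (Derived.last D₀)) (Derived.last D₁) _ _
             (subst (λ L → Represents L _) (sym (lookup-∷ʳ-inject₁ (Derived.lines D₀) _ (Derived.last D₀)))
               (Derived.represents D₀))
             (Derived.represents D₁) (represents-≗ (diagramOf-represents S) splits))

module BlockElimination (Φ : PCNF) (PD : PathDecomposition Φ) (k : ℕ) (narrow : WidthAtMost PD k)
             (T : ℕ) (2^k≤T : 2 ^ k ≤ T) (σ : UStrategy Φ) (win : Winning Φ σ) where
  open PathOrder Φ PD
  open Derivations Φ order (3 + n Φ * T)
  open Deriving Φ PD k narrow T 2^k≤T
  open Strategy Φ σ
  open System

  matrix : System order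
  matrix = clausesBefore (m Φ)

  matrix-refuted : Refuted (n Φ) (fun matrix)
  matrix-refuted a consistent with fun matrix a in sat | win a (λ u ∀u → consistent u ∀u (FP.toℕ<n u))
  ... | false | _ = refl
  ... | true | c , falsified
    with trans (sym (Equivalence.to (clausesWhere-fun _ a) sat c (dec-true (toℕ c N.<? m Φ) (FP.toℕ<n c)))) falsified
  ...   | ()

  derived-matrix : Σ (Derived matrix) λ D → Derived.len D ≤ m Φ + m Φ
  derived-matrix = all-clauses (m Φ) refl (has-clause win)
    where
    all-clauses : ∀ j → j ≡ m Φ → 0 < j → Σ (Derived (clausesBefore j)) λ D → Derived.len D ≤ m Φ + m Φ
    all-clauses (suc j) j≡m _ =
      let (D , len≡) = conjunction j (NP.≤-reflexive j≡m) in D , NP.≤-reflexive (trans len≡ (cong (m Φ +_) j≡m))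

  between : ℕ → ℕ → Fin (n Φ) → Bool
  between s e x = does (s N.≤? toℕ x) ∧ does (toℕ x N.<? e)

  blockSystem : Quant → System order → ℕ → ℕ → System order
  blockSystem q B s e = system (width B) (quantify q (layered B) (between s e))

  blockSystem-support : ∀ q B s e → s ≤ e → (∀ x → support B x ≡ does (toℕ x N.<? e)) →
    ∀ x → support (blockSystem q B s e) x ≡ does (toℕ x N.<? s)
  blockSystem-support q B s e s≤e B-support x
    rewrite quantify-support q (layered B) (between s e) x | B-support x
    with toℕ x N.<? s
  ... | yes x<s rewrite dec-true (toℕ x N.<? e) (NP.<-≤-trans x<s s≤e) | dec-false (s N.≤? toℕ x) (NP.<⇒≱ x<s)
                      | dec-true (toℕ x N.<? s) x<s = refl
  ... | no x≮s with toℕ x N.<? e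
  ...   | yes x<e rewrite dec-true (toℕ x N.<? e) x<e | dec-true (s N.≤? toℕ x) (NP.≮⇒≥ x≮s)
                        | dec-false (toℕ x N.<? s) x≮s = refl
  ...   | no x≮e rewrite dec-false (toℕ x N.<? e) x≮e | dec-false (toℕ x N.<? s) x≮s = refl

  between-sound : ∀ s e y → between s e y ≡ true → s ≤ toℕ y × toℕ y < e
  between-sound s e y = does-∧ (s N.≤? toℕ y) (toℕ y N.<? e)

  between-intro : ∀ s e y → s ≤ toℕ y → toℕ y < e → between s e y ≡ true
  between-intro s e y s≤y y<e = ∧-intro (dec-true (s N.≤? toℕ y) s≤y) (dec-true (toℕ y N.<? e) y<e)

  between-shrink : ∀ s e y → between (suc s) e y ≡ true → between s e y ≡ true
  between-shrink s e y inside = let (s<y , y<e) = between-sound (suc s) e y inside in between-intro s e y (NP.<⇒≤ s<y) y<e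

  between-peel : ∀ x s e y → toℕ x ≡ s → between s e y ≡ true → between (suc s) e y ≡ false → y ≡ x
  between-peel x s e y x≡s inside outside with between-sound s e y inside | suc s N.≤? toℕ y
  ... | s≤y , y<e | yes s<y with trans (sym outside) (between-intro (suc s) e y s<y y<e)
  ...   | ()
  between-peel x s e y x≡s inside outside | s≤y , y<e | no s≮y =
    FP.toℕ-injective (trans (NP.≤-antisym (NP.≤-pred (NP.≰⇒> s≮y)) s≤y) (sym x≡s))

  between-first : ∀ x s e → toℕ x ≡ s → s < e → between s e x ≡ true
  between-first x s e x≡s s<e = between-intro s e x (NP.≤-reflexive (sym x≡s)) (subst (_< e) (sym x≡s) s<e)

  between-single : ∀ x s y → toℕ x ≡ s → between s (suc s) y ≡ true → y ≡ x
  between-single x s y x≡s inside = let (s≤y , y<ss) = between-sound s (suc s) y inside in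
    FP.toℕ-injective (trans (NP.≤-antisym (NP.≤-pred y<ss) s≤y) (sym x≡s))

  advance : ∀ t x S S′ → toℕ x ≡ t → (D′ : Derived S′) → Refuted (suc t) (fun S′) →
    (∀ v → support S′ v ≡ does (toℕ v N.<? suc t)) → width S ≤ T → width S′ ≤ T → Splits S S′ x →
    Σ (Derived S) (λ D → Derived.len D ≤ 3 + Derived.len D′) × Refuted t (fun S)
  advance t x S S′ x≡t D′ refuted′ S′-support wS wS′ splits =
    eliminate x D′ S′x maximal wS wS′ splits ,
    subst (λ j → Refuted j (fun S)) x≡t
      (refuted-step x (fun S) (fun S′) splits (subst (λ j → Refuted (suc j) (fun S′)) (sym x≡t) refuted′))
    where
    S′x : support S′ x ≡ true
    S′x = trans (S′-support x) (dec-true (toℕ x N.<? suc t) (s≤s (NP.≤-reflexive x≡t)))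
    maximal : ∀ v → support S′ v ≡ true → v F.≤ x
    maximal v S′v = NP.≤-trans (NP.≤-pred (does-true⇒ (toℕ v N.<? suc t) (trans (sym (S′-support v)) S′v)))
                      (NP.≤-reflexive (sym x≡t))

  step-length : ∀ a s {len len′} → len ≤ 3 + len′ → len′ ≤ a + 3 * s → len ≤ a + 3 * suc s
  step-length a s len≤ len′≤ = NP.≤-trans len≤ (NP.≤-trans (NP.+-monoʳ-≤ 3 len′≤) (NP.≤-reflexive rearrange))
    where
    rearrange : 3 + (a + 3 * s) ≡ a + 3 * suc s
    rearrange = trans (NP.+-comm 3 (a + 3 * s))
                  (trans (NP.+-assoc a (3 * s) 3) (cong (a +_) (trans (NP.+-comm (3 * s) 3) (sym (NP.*-suc 3 s)))))

  record Stage (t : ℕ) (q : Quant) (b steps : ℕ) : Set where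
    field
      end          : ℕ
      t<end        : t < end
      base         : System order
      base-width   : width base ≤ tower k b
      base-support : ∀ x → support base x ≡ does (toℕ x N.<? end)
      derived      : Derived (blockSystem q base t end)
      length       : Derived.len derived ≤ (m Φ + m Φ) + 3 * steps
      refuted      : Refuted t (fun (blockSystem q base t end))

    current : System order
    current = blockSystem q base t end

    current-support : ∀ x → support current x ≡ does (toℕ x N.<? t)
    current-support = blockSystem-support q base t end (NP.<⇒≤ t<end) base-support

    current-width : width current ≤ tower k (suc b)
    current-width = NP.^-monoʳ-≤ 2 base-width

  open Stage

  same-block : ∀ {b s} t q q′ x → q ≡ q′ → toℕ x ≡ t → Q Φ x ≡ q → (R : Stage (suc t) q′ b s) →
    tower k (suc b) ≤ T → Stage t q b (suc s)
  same-block t q .q x refl x≡t Qx R wT = record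
    { end          = end R
    ; t<end        = t<e
    ; base         = base R
    ; base-width   = base-width R
    ; base-support = base-support R
    ; derived      = proj₁ (proj₁ adv)
    ; length       = step-length _ _ (proj₂ (proj₁ adv)) (length R)
    ; refuted      = proj₂ adv
    }
    where
    t<e = NP.<-trans (NP.n<1+n t) (t<end R)
    S = blockSystem q (base R) t (end R)
    splits : Splits S (current R) x
    splits = splits-by {S} {current R} q x Qx
      (quantify-split q (layered (base R)) (between t (end R)) (between (suc t) (end R)) x (between-shrink t (end R))
        (λ y → between-peel x t (end R) y x≡t) (between-first x t (end R) x≡t t<e))
    adv = advance t x S (current R) x≡t (derived R) (refuted R) (current-support R)
            (NP.≤-trans (current-width R) wT) (NP.≤-trans (current-width R) wT) splits

  new-block : ∀ {b s} t q q′ x → toℕ x ≡ t → Q Φ x ≡ q → (R : Stage (suc t) q′ b s) →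
    tower k (suc (suc b)) ≤ T → Stage t q (suc b) (suc s)
  new-block {b} t q q′ x x≡t Qx R wT = record
    { end          = suc t
    ; t<end        = NP.n<1+n t
    ; base         = current R
    ; base-width   = current-width R
    ; base-support = current-support R
    ; derived      = proj₁ (proj₁ adv)
    ; length       = step-length _ _ (proj₂ (proj₁ adv)) (length R)
    ; refuted      = proj₂ adv
    }
    where
    S = blockSystem q (current R) t (suc t)
    splits : Splits S (current R) x
    splits = splits-by {S} {current R} q x Qx
      (quantify-single q (layered (current R)) (between t (suc t)) x (λ y → between-single x t y x≡t)
        (between-first x t (suc t) x≡t (NP.n<1+n t)))
    adv = advance t x S (current R) x≡t (derived R) (refuted R) (current-support R)
            (NP.≤-trans (NP.^-monoʳ-≤ 2 (current-width R)) wT)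
            (NP.≤-trans (current-width R) (NP.≤-trans (tower-mono k (NP.n≤1+n (suc b))) wT)) splits

  extend-stage : ∀ {b s} t q q′ x → toℕ x ≡ t → Q Φ x ≡ q → Stage (suc t) q′ b s →
    tower k (suc ((if sameQ q q′ then 0 else 1) + b)) ≤ T → Stage t q ((if sameQ q q′ then 0 else 1) + b) (suc s)
  extend-stage t q q′ x x≡t Qx R wT with sameQ q q′ in same
  ... | true  = same-block t q q′ x (sameQ-sound q q′ same) x≡t Qx R wT
  ... | false = new-block t q q′ x x≡t Qx R wT

  stage : ∀ {l} t q (qs : Vec Quant l) → t + suc l ≡ n Φ → QuantifiersFrom Φ t (q V.∷ qs) →
    tower k (suc (blocks (q V.∷ qs))) ≤ T → Stage t q (blocks (q V.∷ qs)) (suc l)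
  stage t q V.[] t+1≡n quantifiers wT = record
    { end          = suc t
    ; t<end        = NP.n<1+n t
    ; base         = matrix
    ; base-width   = NP.≤-refl
    ; base-support = matrix-support
    ; derived      = proj₁ (proj₁ adv)
    ; length       = step-length _ 0 (proj₂ (proj₁ adv))
                       (NP.≤-trans (proj₂ derived-matrix) (NP.≤-reflexive (sym (NP.+-identityʳ _))))
    ; refuted      = proj₂ adv
    }
    where
    n≡ : suc t ≡ n Φ
    n≡ = trans (NP.+-comm 1 t) t+1≡n
    t<n = subst (t <_) n≡ (NP.n<1+n t)
    x = F.fromℕ< t<n
    x≡t = FP.toℕ-fromℕ< t<n
    matrix-support : ∀ v → support matrix v ≡ does (toℕ v N.<? suc t)
    matrix-support v = sym (dec-true (toℕ v N.<? suc t) (subst (toℕ v <_) (sym n≡) (FP.toℕ<n v)))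
    S = blockSystem q matrix t (suc t)
    splits : Splits S matrix x
    splits = splits-by {S} {matrix} q x (quantifiers F.zero x (trans x≡t (sym (NP.+-identityʳ t))))
      (quantify-single q (layered matrix) (between t (suc t)) x (λ y → between-single x t y x≡t)
        (between-first x t (suc t) x≡t (NP.n<1+n t)))
    adv = advance t x S matrix x≡t (proj₁ derived-matrix) (subst (λ j → Refuted j (fun matrix)) (sym n≡) matrix-refuted)
            matrix-support wT 2^k≤T splits
  stage {suc l} t q (q′ V.∷ qs) t+l≡n quantifiers wT = extend-stage t q q′ x x≡t Qx R wT
    where
    t<n = subst (t <_) t+l≡n (NP.m<m+n t (s≤s z≤n))
    x = F.fromℕ< t<n
    x≡t = FP.toℕ-fromℕ< t<n
    Qx = quantifiers F.zero x (trans x≡t (sym (NP.+-identityʳ t)))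
    R = stage (suc t) q′ qs (trans (sym (NP.+-suc t (suc l))) t+l≡n)
          (λ i y eq → quantifiers (F.suc i) y (trans eq (sym (NP.+-suc t (toℕ i)))))
          (NP.≤-trans (tower-mono k (s≤s (blocks-cons q (q′ V.∷ qs)))) wT)

  Refutation : ℕ → Set
  Refutation bound = Σ (Derivation Φ order) λ R → IsRefutation Φ order R × derivationSize Φ order R ≤ bound

  refutes : ∀ {S} (D : Derived S) → ∀ {len} → Derived.len D ≤ len → Refuted 0 (fun S) → Refutation (len * (3 + n Φ * T))
  refutes D len≤ refuted =
    let (R , is-refutation , size≤) = refutation (Derived.partial D) (Derived.last D) (Derived.last-is-last D)
                                        (represents-≗ (Derived.represents D) (λ a → refuted a (λ u _ ())))
    in R , is-refutation , NP.≤-trans size≤ (NP.*-monoˡ-≤ _ len≤)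

  short-refutation : tower k (suc (blocks (prefix Φ))) ≤ T → Refutation (((m Φ + m Φ) + 3 * n Φ) * (3 + n Φ * T))
  short-refutation wT with prefixView Φ
  ... | empty n≡0 = refutes (proj₁ derived-matrix) (NP.≤-trans (proj₂ derived-matrix) (NP.m≤m+n _ _))
                      (subst (λ j → Refuted j (fun matrix)) n≡0 matrix-refuted)
  ... | nonempty q qs l+1≡n blocks≡ quantifiers =
    refutes (derived R) (subst (λ j → Derived.len (derived R) ≤ (m Φ + m Φ) + 3 * j) l+1≡n (length R)) (refuted R)
    where
    R = stage 0 q qs l+1≡n quantifiers (subst (λ b → tower k (suc b) ≤ T) blocks≡ wT)

size-polynomial : Poly
size-polynomial = 0 ∷ 15 ∷ 5 ∷ []

size-bound : ∀ n m L T → 1 ≤ T → ((m + m) + 3 * n) * (3 + n * T) ≤ T * evalPoly size-polynomial (n + m + L)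
size-bound n m L T 1≤T = NP.≤-trans (NP.*-mono-≤ lines≤ line≤) (NP.≤-reflexive (expand x T))
  where
  x = n + m + L
  m≤x : m ≤ x
  m≤x = NP.≤-trans (NP.m≤n+m m n) (NP.m≤m+n (n + m) L)
  n≤x : n ≤ x
  n≤x = NP.≤-trans (NP.m≤m+n n m) (NP.m≤m+n (n + m) L)
  lines≤ : (m + m) + 3 * n ≤ 5 * x
  lines≤ = NP.≤-trans (NP.+-mono-≤ (NP.+-mono-≤ m≤x m≤x) (NP.*-monoʳ-≤ 3 n≤x))
                     (NP.≤-reflexive (solve 1 (λ x → (x :+ x) :+ con 3 :* x := con 5 :* x) refl x))
  line≤ : 3 + n * T ≤ (3 + x) * T
  line≤ = NP.≤-trans (NP.+-mono-≤ (NP.≤-trans (NP.≤-reflexive (sym (NP.*-identityʳ 3))) (NP.*-monoʳ-≤ 3 1≤T))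
                                  (NP.*-monoˡ-≤ T n≤x))
                     (NP.≤-reflexive (sym (NP.*-distribʳ-+ T 3 x)))
  expand : ∀ x T → (5 * x) * ((3 + x) * T) ≡ T * evalPoly size-polynomial x
  expand = solve 2 (λ x T → (con 5 :* x) :* ((con 3 :+ x) :* T) := T :* (con 0 :+ x :* (con 15 :+ x :* (con 5 :+ x :* con 0)))) refl

corollary1 : Σ Poly λ p → ∀ (q k : ℕ) (Φ : PCNF) →
    IsFalse Φ → blocks (prefix Φ) ≤ q → PathwidthAtMost Φ k →
    Σ (Permutation′ (n Φ)) λ π → Σ (Derivation Φ π) λ D →
      IsRefutation Φ π D × derivationSize Φ π D ≤ tower k (suc q) * evalPoly p (formulaSize Φ)
corollary1 = size-polynomial , λ q k Φ (σ , win) blocks≤q (PD , narrow) →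
  let T = tower k (suc q)
      (R , is-refutation , size≤) = BlockElimination.short-refutation Φ PD k narrow T
                                      (tower-mono k {1} {suc q} (s≤s z≤n)) σ win (tower-mono k (s≤s blocks≤q))
  in PathOrder.order Φ PD , R , is-refutation , NP.≤-trans size≤ (size-bound (n Φ) (m Φ) _ T (NP.m^n>0 2 (tower k q)))
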